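{- Let $r=\sqrt{1-2t}$. As formal power series, \[ \sum_{n=0}^{\infty}\sum_{\pi\in\mathfrak{J}_{n}}t^{\operatorname{asc}(\pi)}\frac{x^{n}}{n!}=1+\frac{2(e^{rx}-1)}{1+r+(r-1)e^{rx}}. \]
   Context: A permutation of a finite set $S$ of positive integers is a word $\pi=\pi_1\pi_2\cdots\pi_n$ ($n=|S|$) in which each element of $S$ appears exactly once; the empty word is the unique permutation of the empty set. $\mathfrak{S}_n$ denotes the set of permutations of $\{1,\dots,n\}$. For a permutation $\pi$ of $S$ and a letter $x$ of $\pi$, let $\rho_\pi(x)$ be the maximal consecutive subword of $\pi$ consisting of the letters immediately to the right of $x$ that are all larger than $x$. A permutation $\pi$ is Jacobi if $|\rho_\pi(x)|$ is even for every letter $x$ of $\pi$. $\mathfrak{J}_n$ is the set of Jacobi permutations in $\mathfrak{S}_n$ (so $\mathfrak{J}_0$ consists of the empty permutation). An ascent of $\pi\in\mathfrak{S}_n$ is an index $k\in[n-1]$ with $\pi_k<\pi_{k+1}$, and $\operatorname{asc}(\pi)$ is the number of ascents. -}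

module Defs where

open import Data.Nat as ℕ using (ℕ; zero; suc; _∸_; _<ᵇ_; _≡ᵇ_; _!)
open import Data.Nat.Properties using (_!≢0)
open import Data.Bool using (Bool; true; false; _∧_; not; if_then_else_)
open import Data.List using (List; []; _∷_; length; filter; takeWhile; concatMap; map; upTo)
open import Data.Bool.ListAction using (any)
open import Data.Integer using (+_)
open import Data.Rational using (ℚ; 0ℚ; 1ℚ; _+_; _*_; _-_; _/_)
open import Relation.Nullary.Decidable using (Dec)
open import Relation.Binary.PropositionalEquality using (_≡_)
open import Data.Bool using (T)
open import Relation.Nullary.Decidable using (T?)

words : ℕ → ℕ → List (List ℕ)
words zero    n = [] ∷ []
words (suc m) n = concatMap (λ w → map (λ a → suc a ∷ w) (upTo n)) (words m n)

elemᵇ : ℕ → List ℕ → Bool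
elemᵇ a w = any (λ b → a ≡ᵇ b) w

distinctᵇ : List ℕ → Bool
distinctᵇ []      = true
distinctᵇ (a ∷ w) = not (elemᵇ a w) ∧ distinctᵇ w

perms : ℕ → List (List ℕ)
perms n = filter (λ w → T? (distinctᵇ w)) (words n n)

ρlen : ℕ → List ℕ → ℕ
ρlen x rest = length (takeWhile (λ y → T? (x <ᵇ y)) rest)

evenᵇ : ℕ → Bool
evenᵇ zero          = true
evenᵇ (suc zero)    = false
evenᵇ (suc (suc n)) = evenᵇ n

isJacobiᵇ : List ℕ → Bool
isJacobiᵇ []         = true
isJacobiᵇ (x ∷ rest) = evenᵇ (ρlen x rest) ∧ isJacobiᵇ rest

asc : List ℕ → ℕ
asc []            = 0
asc (x ∷ [])      = 0
asc (x ∷ y ∷ rest) = (if x <ᵇ y then 1 else 0) ℕ.+ asc (y ∷ rest)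

jacobiCount : ℕ → ℕ → ℕ
jacobiCount n k =
  length (filter (λ π → T? (isJacobiᵇ π ∧ (asc π ≡ᵇ k))) (perms n))

Σ≤ : ℕ → (ℕ → ℚ) → ℚ
Σ≤ zero    f = f 0
Σ≤ (suc n) f = Σ≤ n f + f (suc n)

-- ℚ[[t]] : coefficient of t^k
Ser₁ : Set
Ser₁ = ℕ → ℚ

_*₁_ : Ser₁ → Ser₁ → Ser₁
(a *₁ b) k = Σ≤ k (λ i → a i * b (k ∸ i))

one₁ : Ser₁
one₁ zero    = 1ℚ
one₁ (suc _) = 0ℚ

_^₁_ : Ser₁ → ℕ → Ser₁
a ^₁ zero  = one₁
a ^₁ suc n = a *₁ (a ^₁ n)

oneMinus2t : Ser₁
oneMinus2t zero          = 1ℚ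
oneMinus2t (suc zero)    = 0ℚ - ((+ 2) / 1)
oneMinus2t (suc (suc _)) = 0ℚ

-- ℚ[[t]][[x]] = ℚ[[t,x]] : A n k = coefficient of x^n t^k
Ser₂ : Set
Ser₂ = ℕ → Ser₁

_≈₂_ : Ser₂ → Ser₂ → Set
A ≈₂ B = ∀ n k → A n k ≡ B n k

_+₂_ : Ser₂ → Ser₂ → Ser₂
(A +₂ B) n k = A n k + B n k

_-₂_ : Ser₂ → Ser₂ → Ser₂
(A -₂ B) n k = A n k - B n k

_*₂_ : Ser₂ → Ser₂ → Ser₂
(A *₂ B) n = λ k → Σ≤ n (λ i → (A i *₁ B (n ∸ i)) k)

const₂ : Ser₁ → Ser₂
const₂ a zero    = a
const₂ a (suc _) = λ _ → 0ℚ

one₂ : Ser₂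
one₂ = const₂ one₁

two₂ : Ser₂
two₂ = const₂ (λ { zero → (+ 2) / 1 ; (suc _) → 0ℚ })

expX : Ser₁ → Ser₂
expX r n k = (r ^₁ n) k * (_/_ (+ 1) (n !) ⦃ n !≢0 ⦄)

jacobiEGF : Ser₂
jacobiEGF n k = _/_ (+ jacobiCount n k) (n !) ⦃ n !≢0 ⦄

denom : Ser₁ → Ser₂
denom r = (one₂ +₂ const₂ r) +₂ ((const₂ r -₂ one₂) *₂ expX r)

{-# OPTIONS --safe #-}
-- Removing the letter 1 from a Jacobi permutation π = σ 1 τ leaves Jacobi permutations
-- σ and τ of complementary sets with |τ| even, and asc π = asc σ + asc (1 τ). Hence the exponential
-- generating function F satisfies D F = F (1 - t + t E F), with D = ∂/∂x and E F the even part of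
-- F in x. The closed form R = 1 + 2 (e - 1)/(1 + r + (r - 1) e), where e = exp (r x), satisfies
-- R(x) R(-x) = 1, so E R = (R + 1/R)/2, and by r² = 1 - 2t it solves the Riccati equation
-- D R = R - t R + t (R² + 1)/2, which is the same equation. Both series are 1 at x = 0, and the
-- equation determines the coefficient of x^(n+1) from the lower ones, so F = R.
module Submission where

open import Defs
open import Data.Rational using (1ℚ)
open import Relation.Binary.PropositionalEquality using (_≡_)

module Series where

  open import Algebra.Bundles using (CommutativeSemiring; CommutativeRing; RawRing)
  open import Algebra.Solver.Ring.AlmostCommutativeRing
    using (_-Raw-AlmostCommutative⟶_; fromCommutativeRing)
  open import Data.Bool.Base using (if_then_else_)
  open import Data.Nat.Base as ℕ using (ℕ; zero; suc; _∸_; _≤_; z≤n; s≤s)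
  import Data.Nat.Properties as ℕ
  open import Data.Product.Base using (_,_)
  open import Data.Sum.Base using (inj₁; inj₂)
  open import Level using (_⊔_)
  open import Relation.Binary.PropositionalEquality as ≡ using (_≡_)

  module Sums {c ℓ} (R : CommutativeSemiring c ℓ) where
    open CommutativeSemiring R
    open import Relation.Binary.Reasoning.Setoid setoid

    ∑≤ : ℕ → (ℕ → Carrier) → Carrier
    ∑≤ zero    f = f 0
    ∑≤ (suc n) f = ∑≤ n f + f (suc n)

    syntax ∑≤ n (λ i → e) = ∑[ i ≤ n ] e

    ∑-cong : ∀ n {f g : ℕ → Carrier} → (∀ i → i ≤ n → f i ≈ g i) → ∑≤ n f ≈ ∑≤ n g
    ∑-cong zero    f≈g = f≈g 0 z≤n
    ∑-cong (suc n) f≈g = +-cong (∑-cong n λ i i≤n → f≈g i (ℕ.m≤n⇒m≤1+n i≤n)) (f≈g (suc n) ℕ.≤-refl)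

    ∑-congᵉ : ∀ n {f g : ℕ → Carrier} → (∀ i → f i ≡ g i) → ∑≤ n f ≈ ∑≤ n g
    ∑-congᵉ n f≡g = ∑-cong n λ i _ → reflexive (f≡g i)

    ∑-zero : ∀ n {f : ℕ → Carrier} → (∀ i → i ≤ n → f i ≈ 0#) → ∑≤ n f ≈ 0#
    ∑-zero n f≈0 = trans (∑-cong n f≈0) (zeros n)
      where
      zeros : ∀ n → ∑[ i ≤ n ] 0# ≈ 0#
      zeros zero    = refl
      zeros (suc n) = trans (+-identityʳ _) (zeros n)

    ∑-distrib-+ : ∀ n (f g : ℕ → Carrier) → ∑[ i ≤ n ] (f i + g i) ≈ ∑≤ n f + ∑≤ n g
    ∑-distrib-+ zero    f g = refl
    ∑-distrib-+ (suc n) f g = begin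
      ∑[ i ≤ n ] (f i + g i) + (f (suc n) + g (suc n))  ≈⟨ +-congʳ (∑-distrib-+ n f g) ⟩
      (∑≤ n f + ∑≤ n g) + (f (suc n) + g (suc n))       ≈⟨ +-assoc _ _ _ ⟩
      ∑≤ n f + (∑≤ n g + (f (suc n) + g (suc n)))       ≈⟨ +-congˡ (x+[y+z]≈y+[x+z] _ _ _) ⟩
      ∑≤ n f + (f (suc n) + (∑≤ n g + g (suc n)))       ≈⟨ +-assoc _ _ _ ⟨
      ∑≤ (suc n) f + ∑≤ (suc n) g                       ∎
      where
      x+[y+z]≈y+[x+z] : ∀ x y z → x + (y + z) ≈ y + (x + z)
      x+[y+z]≈y+[x+z] x y z =
        trans (sym (+-assoc x y z)) (trans (+-congʳ (+-comm x y)) (+-assoc y x z))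

    ∑-distribˡ : ∀ n a (f : ℕ → Carrier) → a * ∑≤ n f ≈ ∑[ i ≤ n ] (a * f i)
    ∑-distribˡ zero    a f = refl
    ∑-distribˡ (suc n) a f = trans (distribˡ a _ _) (+-congʳ (∑-distribˡ n a f))

    ∑-distribʳ : ∀ n a (f : ℕ → Carrier) → ∑≤ n f * a ≈ ∑[ i ≤ n ] (f i * a)
    ∑-distribʳ zero    a f = refl
    ∑-distribʳ (suc n) a f = trans (distribʳ a _ _) (+-congʳ (∑-distribʳ n a f))

    ∑-suc : ∀ n (f : ℕ → Carrier) → ∑≤ (suc n) f ≈ f 0 + ∑[ i ≤ n ] f (suc i)
    ∑-suc zero    f = refl
    ∑-suc (suc n) f = trans (+-congʳ (∑-suc n f)) (+-assoc _ _ _)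

    ∑-reverse : ∀ n (f : ℕ → Carrier) → ∑≤ n f ≈ ∑[ i ≤ n ] f (n ∸ i)
    ∑-reverse zero    f = refl
    ∑-reverse (suc n) f = sym (begin
      ∑[ i ≤ suc n ] f (suc n ∸ i)     ≈⟨ ∑-suc n (λ i → f (suc n ∸ i)) ⟩
      f (suc n) + ∑[ i ≤ n ] f (n ∸ i) ≈⟨ +-congˡ (∑-reverse n f) ⟨
      f (suc n) + ∑≤ n f               ≈⟨ +-comm _ _ ⟩
      ∑≤ (suc n) f                     ∎)

    -- Both sides sum h i j over the triangle i + j ≤ n.
    ∑-triangle : ∀ n (h : ℕ → ℕ → Carrier) →
                 ∑[ m ≤ n ] ∑[ i ≤ m ] h i (m ∸ i) ≈ ∑[ i ≤ n ] ∑[ j ≤ n ∸ i ] h i j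
    ∑-triangle zero    h = refl
    ∑-triangle (suc n) h = begin
      ∑[ m ≤ n ] ∑[ i ≤ m ] h i (m ∸ i) + ∑[ i ≤ suc n ] h i (suc n ∸ i)
        ≈⟨ +-cong (∑-triangle n h) (+-cong (∑-cong n λ i i≤n → reflexive (≡.cong (h i) (ℕ.+-∸-assoc 1 i≤n)))
                                            (reflexive (≡.cong (h (suc n)) (ℕ.n∸n≡0 n)))) ⟩
      ∑[ i ≤ n ] ∑[ j ≤ n ∸ i ] h i j + (∑[ i ≤ n ] h i (suc (n ∸ i)) + h (suc n) 0)
        ≈⟨ +-assoc _ _ _ ⟨
      (∑[ i ≤ n ] ∑[ j ≤ n ∸ i ] h i j + ∑[ i ≤ n ] h i (suc (n ∸ i))) + h (suc n) 0
        ≈⟨ +-congʳ (∑-distrib-+ n _ _) ⟨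
      ∑[ i ≤ n ] ∑[ j ≤ suc (n ∸ i) ] h i j + h (suc n) 0
        ≈⟨ +-cong (∑-cong n λ i i≤n → reflexive (≡.cong (λ m → ∑≤ m (h i)) (ℕ.+-∸-assoc 1 i≤n)))
                  (reflexive (≡.cong (λ m → ∑≤ m (h (suc n))) (ℕ.n∸n≡0 n))) ⟨
      ∑[ i ≤ suc n ] ∑[ j ≤ suc n ∸ i ] h i j ∎

  module PowerSeries {c ℓ} (R : CommutativeRing c ℓ) where
    open CommutativeRing R hiding (zero)
    open Sums commutativeSemiring public
    open import Relation.Binary.Reasoning.Setoid setoid
    open import Algebra.Properties.Ring ring using (-‿distribˡ-*; -‿distribʳ-*; -0#≈0#; -‿involutive)
    open import Algebra.Properties.AbelianGroup +-abelianGroup using (⁻¹-∙-comm)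
    open import Algebra.Properties.Semiring.Mult semiring public using (_×_)
    open import Algebra.Properties.Semiring.Mult semiring using (×-congʳ; ×-homo-+; ×-assoc-*; ×-comm-*)
    open import Algebra.Properties.CommutativeMonoid.Mult +-commutativeMonoid using (×-distrib-+)

    Series : Set c
    Series = ℕ → Carrier

    -- A record rather than a Π-type, so that unification does not look inside it.
    infix 4 _≋_
    record _≋_ (f g : Series) : Set ℓ where
      constructor mk≋
      field at : ∀ n → f n ≈ g n
    open _≋_ public

    infixl 6 _⊕_
    infixl 7 _⊛_
    infix  8 ⊝_

    _⊕_ : Series → Series → Series
    (f ⊕ g) n = f n + g n

    ⊝_ : Series → Series
    (⊝ f) n = - f n

    _⊛_ : Series → Series → Series
    (f ⊛ g) n = ∑[ i ≤ n ] (f i * g (n ∸ i))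

    const : Carrier → Series
    const a zero    = a
    const a (suc _) = 0#

    𝟘 𝟙 : Series
    𝟘 _ = 0#
    𝟙 = const 1#

    ⊛-cong : ∀ {f f′ g g′} → f ≋ f′ → g ≋ g′ → f ⊛ g ≋ f′ ⊛ g′
    ⊛-cong f≋f′ g≋g′ = mk≋ λ n → ∑-cong n λ i _ → *-cong (at f≋f′ i) (at g≋g′ (n ∸ i))

    ⊛-comm : ∀ f g → f ⊛ g ≋ g ⊛ f
    ⊛-comm f g = mk≋ λ n → trans (∑-reverse n _) (∑-cong n λ i i≤n →
      trans (*-comm _ _) (*-congʳ (reflexive (≡.cong g (ℕ.m∸[m∸n]≡n i≤n)))))

    const-⊛ : ∀ a g → const a ⊛ g ≋ (λ n → a * g n)
    const-⊛ a g = mk≋ λ where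
      zero    → refl
      (suc n) → trans (∑-suc n _) (trans (+-congˡ (∑-zero n λ _ _ → zeroˡ _)) (+-identityʳ _))

    ⊛-assoc : ∀ f g h → (f ⊛ g) ⊛ h ≋ f ⊛ (g ⊛ h)
    ⊛-assoc f g h = mk≋ λ n → begin
      ∑[ m ≤ n ] (∑[ i ≤ m ] (f i * g (m ∸ i)) * h (n ∸ m))
        ≈⟨ ∑-cong n (λ m _ → ∑-distribʳ m _ _) ⟩
      ∑[ m ≤ n ] ∑[ i ≤ m ] (f i * g (m ∸ i) * h (n ∸ m))
        ≈⟨ ∑-cong n (λ m _ → ∑-cong m λ i i≤m →
             trans (*-assoc _ _ _) (*-congˡ (*-congˡ (reflexive (≡.cong h (reindex n i≤m)))))) ⟩
      ∑[ m ≤ n ] ∑[ i ≤ m ] (f i * (g (m ∸ i) * h (n ∸ i ∸ (m ∸ i))))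
        ≈⟨ ∑-triangle n (λ i j → f i * (g j * h (n ∸ i ∸ j))) ⟩
      ∑[ i ≤ n ] ∑[ j ≤ n ∸ i ] (f i * (g j * h (n ∸ i ∸ j)))
        ≈⟨ ∑-cong n (λ i _ → ∑-distribˡ (n ∸ i) _ _) ⟨
      ∑[ i ≤ n ] (f i * ∑[ j ≤ n ∸ i ] (g j * h (n ∸ i ∸ j))) ∎
      where
      reindex : ∀ n {m i} → i ≤ m → n ∸ m ≡ n ∸ i ∸ (m ∸ i)
      reindex n {m} {i} i≤m = ≡.trans (≡.cong (n ∸_) (≡.sym (ℕ.m+[n∸m]≡n i≤m))) (≡.sym (ℕ.∸-+-assoc n i (m ∸ i)))

    ⊛-distribˡ : ∀ f g h → f ⊛ (g ⊕ h) ≋ f ⊛ g ⊕ f ⊛ h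
    ⊛-distribˡ f g h = mk≋ λ n → trans (∑-cong n λ i _ → distribˡ _ _ _) (∑-distrib-+ n _ _)

    ⊛-distribʳ : ∀ f g h → (g ⊕ h) ⊛ f ≋ g ⊛ f ⊕ h ⊛ f
    ⊛-distribʳ f g h = mk≋ λ n → trans (∑-cong n λ i _ → distribʳ _ _ _) (∑-distrib-+ n _ _)

    ⊛-identityˡ : ∀ f → 𝟙 ⊛ f ≋ f
    ⊛-identityˡ f = mk≋ λ n → trans (at (const-⊛ 1# f) n) (*-identityˡ _)

    ⊛-identityʳ : ∀ f → f ⊛ 𝟙 ≋ f
    ⊛-identityʳ f = mk≋ λ n → trans (at (⊛-comm f 𝟙) n) (at (⊛-identityˡ f) n)

    seriesRing : CommutativeRing c ℓ
    seriesRing = record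
      { Carrier = Series ; _≈_ = _≋_ ; _+_ = _⊕_ ; _*_ = _⊛_ ; -_ = ⊝_ ; 0# = 𝟘 ; 1# = 𝟙
      ; isCommutativeRing = record
        { isRing = record
          { +-isAbelianGroup = record
            { isGroup = record
              { isMonoid = record
                { isSemigroup = record
                  { isMagma = record
                    { isEquivalence = record
                      { refl  = mk≋ λ _ → refl
                      ; sym   = λ f≋g → mk≋ λ n → sym (at f≋g n)
                      ; trans = λ f≋g g≋h → mk≋ λ n → trans (at f≋g n) (at g≋h n) }
                    ; ∙-cong = λ f≋f′ g≋g′ → mk≋ λ n → +-cong (at f≋f′ n) (at g≋g′ n) }
                  ; assoc = λ _ _ _ → mk≋ λ _ → +-assoc _ _ _ }
                ; identity = (λ _ → mk≋ λ _ → +-identityˡ _) , (λ _ → mk≋ λ _ → +-identityʳ _) }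
              ; inverse = (λ _ → mk≋ λ _ → -‿inverseˡ _) , (λ _ → mk≋ λ _ → -‿inverseʳ _)
              ; ⁻¹-cong = λ f≋g → mk≋ λ n → -‿cong (at f≋g n) }
            ; comm = λ _ _ → mk≋ λ _ → +-comm _ _ }
          ; *-cong = ⊛-cong
          ; *-assoc = ⊛-assoc
          ; *-identity = ⊛-identityˡ , ⊛-identityʳ
          ; distrib = ⊛-distribˡ , ⊛-distribʳ }
        ; *-comm = ⊛-comm } }

    const-cong : ∀ {a b} → a ≈ b → const a ≋ const b
    const-cong a≈b = mk≋ λ where zero → a≈b ; (suc _) → refl

    const-⊕ : ∀ a b → const a ⊕ const b ≋ const (a + b)
    const-⊕ a b = mk≋ λ where zero → refl ; (suc _) → +-identityˡ 0#

    const-⊝ : ∀ a → ⊝ const a ≋ const (- a)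
    const-⊝ a = mk≋ λ where zero → refl ; (suc _) → -0#≈0#

    const-⊛-const : ∀ a b → const a ⊛ const b ≋ const (a * b)
    const-⊛-const a b = mk≋ λ n → trans (at (const-⊛ a (const b)) n) (scale n)
      where
      scale : ∀ n → a * const b n ≈ const (a * b) n
      scale zero    = refl
      scale (suc n) = zeroʳ a

    ⊛-zeroʳ : ∀ f → f ⊛ 𝟘 ≋ 𝟘
    ⊛-zeroʳ f = mk≋ λ n → ∑-zero n λ _ _ → zeroʳ _

    constantMorphism : ∀ {C : RawRing c c} → C -Raw-AlmostCommutative⟶ fromCommutativeRing R →
                       C -Raw-AlmostCommutative⟶ fromCommutativeRing seriesRing
    constantMorphism M = record
      { ⟦_⟧    = λ a → const ⟦ a ⟧
      ; +-homo = λ a b → mk≋ λ n → trans (at (const-cong (+-homo a b)) n) (sym (at (const-⊕ _ _) n))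
      ; *-homo = λ a b → mk≋ λ n → trans (at (const-cong (*-homo a b)) n) (sym (at (const-⊛-const _ _) n))
      ; -‿homo = λ a → mk≋ λ n → trans (at (const-cong (-‿homo a)) n) (sym (at (const-⊝ _) n))
      ; 0-homo = mk≋ λ where zero → 0-homo ; (suc _) → refl
      ; 1-homo = const-cong 1-homo }
      where open _-Raw-AlmostCommutative⟶_ M

    D : Series → Series
    D f n = suc n × f (suc n)

    ×-neg : ∀ n x → n × (- x) ≈ - (n × x)
    ×-neg zero    x = sym -0#≈0#
    ×-neg (suc n) x = trans (+-congˡ (×-neg n x)) (⁻¹-∙-comm x (n × x))

    ×-zero : ∀ n → n × 0# ≈ 0#
    ×-zero zero    = refl
    ×-zero (suc n) = trans (+-identityˡ _) (×-zero n)

    ×-∑ : ∀ m n (f : ℕ → Carrier) → m × ∑≤ n f ≈ ∑[ i ≤ n ] (m × f i)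
    ×-∑ m zero    f = refl
    ×-∑ m (suc n) f = trans (×-distrib-+ _ _ m) (+-congʳ (×-∑ m n f))

    D-cong : ∀ {f g} → f ≋ g → D f ≋ D g
    D-cong f≋g = mk≋ λ n → ×-congʳ (suc n) (at f≋g (suc n))

    D-⊕ : ∀ f g → D (f ⊕ g) ≋ D f ⊕ D g
    D-⊕ f g = mk≋ λ n → ×-distrib-+ _ _ (suc n)

    D-⊝ : ∀ f → D (⊝ f) ≋ ⊝ D f
    D-⊝ f = mk≋ λ n → ×-neg (suc n) _

    D-const : ∀ a → D (const a) ≋ 𝟘
    D-const a = mk≋ λ n → ×-zero (suc n)

    -- The weight (i + j) of the term f i g j splits as i for D f ⊛ g and j for f ⊛ D g.
    D-⊛ : ∀ f g → D (f ⊛ g) ≋ D f ⊛ g ⊕ f ⊛ D g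
    D-⊛ f g = mk≋ λ n → begin
      suc n × ∑[ i ≤ suc n ] (f i * g (suc n ∸ i))
        ≈⟨ ×-∑ (suc n) (suc n) _ ⟩
      ∑[ i ≤ suc n ] (suc n × (f i * g (suc n ∸ i)))
        ≈⟨ ∑-cong (suc n) (λ i i≤ → trans (reflexive (≡.cong (_× (f i * g (suc n ∸ i))) (≡.sym (ℕ.m+[n∸m]≡n i≤))))
                                           (×-homo-+ _ i (suc n ∸ i))) ⟩
      ∑[ i ≤ suc n ] (i × (f i * g (suc n ∸ i)) + (suc n ∸ i) × (f i * g (suc n ∸ i)))
        ≈⟨ ∑-distrib-+ (suc n) _ _ ⟩
      ∑[ i ≤ suc n ] (i × (f i * g (suc n ∸ i))) + ∑[ i ≤ suc n ] ((suc n ∸ i) × (f i * g (suc n ∸ i)))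
        ≈⟨ +-cong (left n) (right n) ⟩
      (D f ⊛ g ⊕ f ⊛ D g) n ∎
      where
      left : ∀ n → ∑[ i ≤ suc n ] (i × (f i * g (suc n ∸ i))) ≈ (D f ⊛ g) n
      left n = trans (∑-suc n _) (trans (+-identityˡ _) (∑-cong n λ i _ → sym (×-assoc-* (suc i) _ _)))
      right : ∀ n → ∑[ i ≤ suc n ] ((suc n ∸ i) × (f i * g (suc n ∸ i))) ≈ (f ⊛ D g) n
      right n = trans (+-congʳ (∑-cong n λ i i≤n →
                      trans (reflexive (≡.cong (λ m → m × (f i * g m)) (ℕ.+-∸-assoc 1 i≤n)))
                            (sym (×-comm-* (suc (n ∸ i)) _ _))))
                    (trans (+-congˡ (reflexive (≡.cong (λ m → m × (f (suc n) * g m)) (ℕ.n∸n≡0 n))))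
                           (+-identityʳ _))

    signed : ℕ → Carrier → Carrier
    signed zero    x = x
    signed (suc n) x = - signed n x

    signed-cong : ∀ n {x y} → x ≈ y → signed n x ≈ signed n y
    signed-cong zero    x≈y = x≈y
    signed-cong (suc n) x≈y = -‿cong (signed-cong n x≈y)

    signed-+ : ∀ n x y → signed n (x + y) ≈ signed n x + signed n y
    signed-+ zero    x y = refl
    signed-+ (suc n) x y = trans (-‿cong (signed-+ n x y)) (sym (⁻¹-∙-comm _ _))

    signed-* : ∀ m n x y → signed m x * signed n y ≈ signed (m ℕ.+ n) (x * y)
    signed-* zero    zero    x y = refl
    signed-* zero    (suc n) x y = trans (sym (-‿distribʳ-* x _)) (-‿cong (signed-* zero n x y))
    signed-* (suc m) n       x y = trans (sym (-‿distribˡ-* _ _)) (-‿cong (signed-* m n x y))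

    signed-× : ∀ n m x → signed n (m × x) ≈ m × signed n x
    signed-× zero    m x = refl
    signed-× (suc n) m x = trans (-‿cong (signed-× n m x)) (sym (×-neg m _))

    reflect : Series → Series
    reflect f n = signed n (f n)

    reflect-cong : ∀ {f g} → f ≋ g → reflect f ≋ reflect g
    reflect-cong f≋g = mk≋ λ n → signed-cong n (at f≋g n)

    reflect-⊕ : ∀ f g → reflect (f ⊕ g) ≋ reflect f ⊕ reflect g
    reflect-⊕ f g = mk≋ λ n → signed-+ n _ _

    reflect-⊝ : ∀ f → reflect (⊝ f) ≋ ⊝ reflect f
    reflect-⊝ f = mk≋ λ n → signed-neg n (f n)
      where
      signed-neg : ∀ n x → signed n (- x) ≈ - signed n x
      signed-neg zero    x = refl
      signed-neg (suc n) x = -‿cong (signed-neg n x)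

    reflect-const : ∀ a → reflect (const a) ≋ const a
    reflect-const a = mk≋ λ where zero → refl ; (suc n) → zeros (suc n)
      where
      zeros : ∀ n → signed n 0# ≈ 0#
      zeros zero    = refl
      zeros (suc n) = trans (-‿cong (zeros n)) -0#≈0#

    reflect-⊛ : ∀ f g → reflect (f ⊛ g) ≋ reflect f ⊛ reflect g
    reflect-⊛ f g = mk≋ λ n → trans (signed-∑ n n _) (∑-cong n λ i i≤n →
      sym (trans (signed-* i (n ∸ i) _ _) (reflexive (≡.cong (λ m → signed m (f i * g (n ∸ i))) (ℕ.m+[n∸m]≡n i≤n)))))
      where
      signed-∑ : ∀ m n (h : ℕ → Carrier) → signed m (∑≤ n h) ≈ ∑[ i ≤ n ] signed m (h i)
      signed-∑ m zero    h = refl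
      signed-∑ m (suc n) h = trans (signed-+ m _ _) (+-congʳ (signed-∑ m n h))

    D-reflect : ∀ f → D (reflect f) ≋ ⊝ reflect (D f)
    D-reflect f = mk≋ λ n → trans (×-neg (suc n) _) (-‿cong (sym (signed-× n (suc n) _)))

    evenPart : Series → Series
    evenPart f n = if evenᵇ n then f n else 0#

    evenPart-⊕ : ∀ f → evenPart f ⊕ evenPart f ≋ f ⊕ reflect f
    evenPart-⊕ f = mk≋ λ n → parity n (f n)
      where
      parity : ∀ n x → (if evenᵇ n then x else 0#) + (if evenᵇ n then x else 0#) ≈ x + signed n x
      parity zero          x = refl
      parity (suc zero)    x = trans (+-identityˡ 0#) (sym (-‿inverseʳ x))
      parity (suc (suc n)) x = trans (parity n x) (+-congˡ (sym (-‿involutive (signed n x))))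

    Causal : (Series → Series) → Set (c ⊔ ℓ)
    Causal G = ∀ {X Y} m → (∀ i → i ≤ m → X i ≈ Y i) → G X m ≈ G Y m

    module _ (×-cancel : ∀ n {x y} → suc n × x ≈ suc n × y → x ≈ y) where

      D≋⊛-unique : ∀ G → Causal G → ∀ {X Y} → X 0 ≈ Y 0 →
                   D X ≋ X ⊛ G X → D Y ≋ Y ⊛ G Y → X ≋ Y
      D≋⊛-unique G causal {X} {Y} X₀≈Y₀ DX DY = mk≋ λ n → below n n ℕ.≤-refl
        where
        below : ∀ N i → i ≤ N → X i ≈ Y i
        below zero    zero    z≤n = X₀≈Y₀
        below (suc N) i       i≤ with ℕ.m≤n⇒m<n∨m≡n i≤
        ... | inj₁ (s≤s i≤N) = below N i i≤N
        ... | inj₂ ≡.refl    = ×-cancel N (begin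
          D X N         ≈⟨ at DX N ⟩
          (X ⊛ G X) N   ≈⟨ ∑-cong N (λ j j≤N → *-cong (below N j j≤N)
                             (causal (N ∸ j) λ i i≤ → below N i (ℕ.≤-trans i≤ (ℕ.m∸n≤m N j)))) ⟩
          (Y ⊛ G Y) N   ≈⟨ at DY N ⟨
          D Y N         ∎)

      D≋𝟘⇒≋const : ∀ {X} → D X ≋ 𝟘 → X ≋ const (X 0)
      D≋𝟘⇒≋const {X} DX≋𝟘 = D≋⊛-unique (λ _ → 𝟘) (λ _ _ → refl) refl
        (mk≋ λ n → trans (at DX≋𝟘 n) (sym (at (⊛-zeroʳ X) n)))
        (mk≋ λ n → trans (at (D-const (X 0)) n) (sym (at (⊛-zeroʳ _) n)))

module ListLemmas where

  open import Data.Bool.Base using (Bool; true; false)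
  open import Data.Empty using (⊥-elim)
  open import Data.List.Base using (List; []; _∷_; _++_; length; filter; map; concatMap; cartesianProductWith)
  open import Data.List.Properties using (length-++; filter-++; map-++)
  open import Data.Nat.ListAction using (sum)
  open import Data.Nat.ListAction.Properties using (sum-++)
  open import Data.List.Membership.Propositional using (_∈_)
  open import Data.List.Membership.Propositional.Properties
    using (∈-map⁻; ∈-concatMap⁻; ∈-∃++; ∈-cartesianProductWith⁻)
  open import Data.List.Membership.Propositional.Properties.WithK using (unique∧set⇒bag)
  open import Data.List.Membership.DecPropositional using () renaming (_∈?_ to ∈?)
  open import Data.List.Relation.Binary.BagAndSetEquality using (∼bag⇒↭)
  open import Data.List.Relation.Binary.Permutation.Propositional using (_↭_; ↭⇒↭ₛ′)
  open import Data.List.Relation.Binary.Permutation.Propositional.Properties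
    using (↭-length; filter-↭; ∈-resp-↭; shift)
  import Data.List.Relation.Binary.Permutation.Setoid.Properties as SetoidPermutation
  open import Data.List.Relation.Binary.Disjoint.Propositional using (Disjoint)
  open import Data.List.Relation.Binary.Subset.Propositional using (_⊆_)
  open import Data.List.Relation.Unary.Any using (here; there)
  open import Data.List.Relation.Unary.All using ([]; _∷_) renaming (lookup to All-lookup; tabulate to All-tabulate)
  open import Data.List.Relation.Unary.AllPairs using ([]; _∷_)
  open import Data.List.Relation.Unary.Unique.Propositional using (Unique)
  import Data.List.Relation.Unary.Unique.Propositional.Properties as UniqueProp
  open UniqueProp using (++⁺)
  open import Data.List.Membership.Propositional using (find)
  open import Data.Nat.Base using (ℕ; suc; _+_; _≤_; s≤s; z≤n)
  open import Data.Nat.Properties using (≤-trans; ≤-reflexive; <-irrefl)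
  open import Data.Product.Base using (_×_; _,_; proj₁; proj₂)
  open import Function.Base using (_∘_)
  open import Function.Bundles using (mk⇔)
  open import Level using (Level)
  open import Relation.Binary.Definitions using (DecidableEquality)
  open import Relation.Binary.PropositionalEquality as ≡ using (_≡_; refl; cong)
  open import Relation.Nullary.Decidable using (T?; yes; no)

  private variable
    a : Level
    A B : Set a

  count : (A → Bool) → List A → ℕ
  count p xs = length (filter (λ x → T? (p x)) xs)

  count-++ : ∀ (p : A → Bool) xs ys → count p (xs ++ ys) ≡ count p xs + count p ys
  count-++ p xs ys = ≡.trans (cong length (filter-++ _ xs ys)) (length-++ (filter _ xs))

  count-concatMap : ∀ (p : B → Bool) (f : A → List B) xs →
                    count p (concatMap f xs) ≡ sum (map (count p ∘ f) xs)
  count-concatMap p f []       = refl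
  count-concatMap p f (x ∷ xs) =
    ≡.trans (count-++ p (f x) (concatMap f xs)) (cong (count p (f x) +_) (count-concatMap p f xs))

  count-map : ∀ (p : B → Bool) (f : A → B) xs → count p (map f xs) ≡ count (p ∘ f) xs
  count-map p f []       = refl
  count-map p f (x ∷ xs) with p (f x)
  ... | true  = cong suc (count-map p f xs)
  ... | false = count-map p f xs

  count-cong : ∀ {p q : A → Bool} xs → (∀ {x} → x ∈ xs → p x ≡ q x) → count p xs ≡ count q xs
  count-cong         []       p≡q = refl
  count-cong {q = q} (x ∷ xs) p≡q rewrite p≡q (here refl) with q x
  ... | true  = cong suc (count-cong xs (p≡q ∘ there))
  ... | false = count-cong xs (p≡q ∘ there)

  count-false : ∀ (xs : List A) → count (λ _ → false) xs ≡ 0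
  count-false []       = refl
  count-false (x ∷ xs) = count-false xs

  count-↭ : ∀ (p : A → Bool) {xs ys} → xs ↭ ys → count p xs ≡ count p ys
  count-↭ p xs↭ys = ↭-length (filter-↭ _ xs↭ys)

  sum-map-++ : ∀ (f : A → ℕ) xs ys → sum (map f (xs ++ ys)) ≡ sum (map f xs) + sum (map f ys)
  sum-map-++ f xs ys = ≡.trans (cong sum (map-++ f xs ys)) (sum-++ (map f xs) _)

  sum-map-cong : ∀ {f g : A → ℕ} xs → (∀ {x} → x ∈ xs → f x ≡ g x) → sum (map f xs) ≡ sum (map g xs)
  sum-map-cong []       f≡g = refl
  sum-map-cong (x ∷ xs) f≡g = ≡.cong₂ _+_ (f≡g (here refl)) (sum-map-cong xs (f≡g ∘ there))

  Unique-resp-↭ : ∀ {xs ys : List A} → xs ↭ ys → Unique xs → Unique ys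
  Unique-resp-↭ {A = A} xs↭ys = SetoidPermutation.Unique-resp-↭ (≡.setoid A) (↭⇒↭ₛ′ ≡.isEquivalence xs↭ys)

  Unique-concatMap : ∀ {f : A → List B} {xs} → Unique xs → (∀ {x} → x ∈ xs → Unique (f x)) →
                     (∀ {x x′ y} → x ∈ xs → x′ ∈ xs → y ∈ f x → y ∈ f x′ → x ≡ x′) →
                     Unique (concatMap f xs)
  Unique-concatMap {xs = []}     []         _   _      = []
  Unique-concatMap {f = f} {xs = x ∷ xs} (x∉ ∷ !xs) !f  f-disj =
    ++⁺ (!f (here refl)) (Unique-concatMap !xs (!f ∘ there) λ p q → f-disj (there p) (there q)) disjoint
    where
    disjoint : Disjoint (f x) (concatMap f xs)
    disjoint (y∈fx , y∈rest) with find (∈-concatMap⁻ _ y∈rest)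
    ... | x′ , x′∈xs , y∈fx′ = All-lookup x∉ x′∈xs (f-disj (here refl) (there x′∈xs) y∈fx y∈fx′)

  Unique⊆⇒length≤ : ∀ {xs ys : List A} → Unique xs → xs ⊆ ys → length xs ≤ length ys
  Unique⊆⇒length≤ {xs = []}     _          _    = z≤n
  Unique⊆⇒length≤ {xs = x ∷ xs} (x∉ ∷ !xs) x∷xs⊆ys with ∈-∃++ (x∷xs⊆ys (here refl))
  ... | ys₁ , ys₂ , refl =
    ≤-trans (s≤s (Unique⊆⇒length≤ !xs xs⊆rest)) (≤-reflexive (≡.sym (↭-length (shift x ys₁ ys₂))))
    where
    xs⊆rest : xs ⊆ ys₁ ++ ys₂
    xs⊆rest z∈xs with ∈-resp-↭ (shift x ys₁ ys₂) (x∷xs⊆ys (there z∈xs))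
    ... | here refl  = ⊥-elim (All-lookup x∉ z∈xs refl)
    ... | there z∈ys = z∈ys

  module _ (_≟_ : DecidableEquality A) where

    Unique⊆∧length≥⇒⊇ : ∀ {xs ys : List A} → Unique xs → xs ⊆ ys → length ys ≤ length xs → ys ⊆ xs
    Unique⊆∧length≥⇒⊇ {xs} {ys} !xs xs⊆ys ys≤xs {y} y∈ys with ∈? _≟_ y xs
    ... | yes y∈xs = y∈xs
    ... | no  y∉xs = ⊥-elim (<-irrefl refl (≤-trans (Unique⊆⇒length≤ (All-y∉ ∷ !xs) y∷xs⊆ys) ys≤xs))
      where
      All-y∉ = All-tabulate λ {z} z∈xs y≡z → y∉xs (≡.subst (_∈ xs) (≡.sym y≡z) z∈xs)
      y∷xs⊆ys : y ∷ xs ⊆ ys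
      y∷xs⊆ys (here refl) = y∈ys
      y∷xs⊆ys (there z∈xs) = xs⊆ys z∈xs

  Unique∧⊇⇒↭ : ∀ {xs ys : List A} → Unique xs → Unique ys → xs ⊆ ys → ys ⊆ xs → xs ↭ ys
  Unique∧⊇⇒↭ !xs !ys xs⊆ys ys⊆xs = ∼bag⇒↭ (unique∧set⇒bag !xs !ys (mk⇔ xs⊆ys ys⊆xs))

  Unique-cartesianProductWith :
    ∀ {c} {C : Set c} (f : A → B → C) {xs ys} →
    (∀ {x x′ y y′} → x ∈ xs → x′ ∈ xs → f x y ≡ f x′ y′ → x ≡ x′ × y ≡ y′) →
    Unique xs → Unique ys → Unique (cartesianProductWith f xs ys)
  Unique-cartesianProductWith f {[]}     f-inj []         !ys = []
  Unique-cartesianProductWith f {x ∷ xs} {ys} f-inj (x∉ ∷ !xs) !ys =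
    ++⁺ (UniqueProp.map⁺ (λ e → proj₂ (f-inj (here refl) (here refl) e)) !ys)
        (Unique-cartesianProductWith f (λ p q → f-inj (there p) (there q)) !xs !ys)
        disjoint
    where
    disjoint : Disjoint (map (f x) ys) (cartesianProductWith f xs ys)
    disjoint (v∈map , v∈rest) with ∈-map⁻ (f x) v∈map | ∈-cartesianProductWith⁻ f xs ys v∈rest
    ... | y , _ , refl | x′ , y′ , x′∈xs , _ , fxy≡fx′y′ =
      All-lookup x∉ x′∈xs (proj₁ (f-inj (here refl) (there x′∈xs) fxy≡fx′y′))

module Arrangements where

  open import Data.Empty using (⊥-elim)
  open import Data.List.Base using (List; []; _∷_; _++_; length; map; concatMap; cartesianProductWith)
  open import Data.List.Properties using (++-assoc; ++-conicalˡ; ++-conicalʳ; length-++; ∷-injective)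
  open import Data.List.Membership.Propositional using (_∈_; _∉_; find; lose)
  open import Data.List.Membership.Propositional.Properties
    using (∈-++⁺ˡ; ∈-++⁺ʳ; ∈-++⁻; ∈-map⁺; ∈-map⁻; ∈-∃++; ∈-concatMap⁺; ∈-concatMap⁻;
           ∈-cartesianProductWith⁺; ∈-cartesianProductWith⁻)
  open import Data.List.Relation.Binary.Permutation.Propositional
    using (_↭_; ↭-refl; ↭-sym; ↭-trans; ↭-reflexive; prep)
  open import Data.List.Relation.Binary.Permutation.Propositional.Properties
    using (↭-length; ↭-empty-inv; ∈-resp-↭; shift; drop-mid; drop-∷) renaming (++⁺ to ++⁺-↭)
  open import Data.List.Relation.Unary.All as All using (All; []; _∷_)
  open import Data.List.Relation.Unary.AllPairs using (AllPairs; []; _∷_)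
  open import Data.List.Relation.Unary.Any using (here; there)
  open import Data.List.Relation.Unary.Unique.Propositional using (Unique)
  open import Data.List.Relation.Unary.Unique.Propositional.Properties using (++⁺; map⁺)
  open import Data.Nat.Base using (ℕ; zero; suc; _+_; _≤_; s≤s)
  open import Data.Nat.Properties using (≤-trans; m≤m+n; m≤n+m)
  open import Data.Product.Base as Product using (∃; ∃₂; _×_; _,_; proj₁; proj₂)
  open import Data.Sum.Base using (_⊎_; inj₁; inj₂)
  open import Function.Base using (_∘_)
  open import Data.List.Relation.Binary.Disjoint.Propositional using (Disjoint)
  open import Level using (Level)
  open import Relation.Binary.Core using (Rel)
  open import Relation.Binary.PropositionalEquality as ≡ using (_≡_; refl; cong)

  open ListLemmas

  private variable
    a r : Level
    A : Set a

  splits : List A → List (List A × List A)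
  splits []       = ([] , []) ∷ []
  splits (x ∷ xs) = map (Product.map₁ (x ∷_)) (splits xs) ++ map (Product.map₂ (x ∷_)) (splits xs)

  ∈-splits⁻ : ∀ (x : A) xs {a b} → (a , b) ∈ splits (x ∷ xs) →
              (∃ λ a′ → a ≡ x ∷ a′ × (a′ , b) ∈ splits xs) ⊎ (∃ λ b′ → b ≡ x ∷ b′ × (a , b′) ∈ splits xs)
  ∈-splits⁻ x xs ab∈ with ∈-++⁻ (map (Product.map₁ (x ∷_)) (splits xs)) ab∈
  ... | inj₁ ab∈ˡ with ∈-map⁻ _ ab∈ˡ
  ...   | (a′ , b) , p , refl = inj₁ (a′ , refl , p)
  ∈-splits⁻ x xs ab∈ | inj₂ ab∈ʳ with ∈-map⁻ _ ab∈ʳ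
  ...   | (a , b′) , p , refl = inj₂ (b′ , refl , p)

  ∈-splits⁺ˡ : ∀ (x : A) xs {a b} → (a , b) ∈ splits xs → (x ∷ a , b) ∈ splits (x ∷ xs)
  ∈-splits⁺ˡ x xs p = ∈-++⁺ˡ (∈-map⁺ (Product.map₁ (x ∷_)) p)

  ∈-splits⁺ʳ : ∀ (x : A) xs {a b} → (a , b) ∈ splits xs → (a , x ∷ b) ∈ splits (x ∷ xs)
  ∈-splits⁺ʳ x xs p = ∈-++⁺ʳ _ (∈-map⁺ (Product.map₂ (x ∷_)) p)

  splits-↭ : ∀ (xs : List A) {a b} → (a , b) ∈ splits xs → a ++ b ↭ xs
  splits-↭ []       (here refl) = ↭-refl
  splits-↭ (x ∷ xs) ab∈ with ∈-splits⁻ x xs ab∈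
  ... | inj₁ (a′ , refl , p) = prep x (splits-↭ xs p)
  ... | inj₂ (b′ , refl , p) = ↭-trans (shift x _ _) (prep x (splits-↭ xs p))

  splits-⊆ˡ : ∀ (xs : List A) {a b z} → (a , b) ∈ splits xs → z ∈ a → z ∈ xs
  splits-⊆ˡ xs ab∈ z∈a = ∈-resp-↭ (splits-↭ xs ab∈) (∈-++⁺ˡ z∈a)

  splits-⊆ʳ : ∀ (xs : List A) {a b z} → (a , b) ∈ splits xs → z ∈ b → z ∈ xs
  splits-⊆ʳ xs ab∈ z∈b = ∈-resp-↭ (splits-↭ xs ab∈) (∈-++⁺ʳ _ z∈b)

  splits-length : ∀ (xs : List A) {a b} → (a , b) ∈ splits xs → length a + length b ≡ length xs
  splits-length xs {a} ab∈ = ≡.trans (≡.sym (length-++ a)) (↭-length (splits-↭ xs ab∈))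

  splits-AllPairs : ∀ {R : Rel A r} {xs a b} → AllPairs R xs → (a , b) ∈ splits xs → AllPairs R a × AllPairs R b
  splits-AllPairs {xs = []}     []         (here refl) = [] , []
  splits-AllPairs {xs = x ∷ xs} (x~ ∷ !xs) ab∈ with ∈-splits⁻ x xs ab∈
  ... | inj₁ (a′ , refl , p) = All.tabulate (All.lookup x~ ∘ splits-⊆ˡ xs p) ∷ proj₁ (splits-AllPairs !xs p)
                             , proj₂ (splits-AllPairs !xs p)
  ... | inj₂ (b′ , refl , p) = proj₁ (splits-AllPairs !xs p)
                             , All.tabulate (All.lookup x~ ∘ splits-⊆ʳ xs p) ∷ proj₂ (splits-AllPairs !xs p)

  private
    dropₗ : ∀ {x : A} {xs} as₁ as₂ bs → (as₁ ++ x ∷ as₂) ++ bs ↭ x ∷ xs → (as₁ ++ as₂) ++ bs ↭ xs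
    dropₗ {x = x} as₁ as₂ bs q = ↭-trans (↭-reflexive (++-assoc as₁ as₂ bs))
      (drop-mid as₁ [] (↭-trans (↭-reflexive (≡.sym (++-assoc as₁ (x ∷ as₂) bs))) q))

    dropᵣ : ∀ {x : A} {xs} as bs₁ bs₂ → as ++ bs₁ ++ x ∷ bs₂ ↭ x ∷ xs → as ++ bs₁ ++ bs₂ ↭ xs
    dropᵣ {x = x} as bs₁ bs₂ q = ↭-trans (↭-reflexive (≡.sym (++-assoc as bs₁ bs₂)))
      (drop-mid (as ++ bs₁) [] (↭-trans (↭-reflexive (++-assoc as bs₁ (x ∷ bs₂))) q))

  splits-complete : ∀ (xs : List A) {as bs} → as ++ bs ↭ xs →
                    ∃₂ λ a b → (a , b) ∈ splits xs × as ↭ a × bs ↭ b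
  splits-complete []       {as} p with ↭-empty-inv p
  ... | as++bs≡[] rewrite ++-conicalˡ as _ as++bs≡[] | ++-conicalʳ as _ as++bs≡[] = [] , [] , here refl , ↭-refl , ↭-refl
  splits-complete (x ∷ xs) {as} {bs} p with ∈-++⁻ as (∈-resp-↭ (↭-sym p) (here refl))
  ... | inj₁ x∈as with ∈-∃++ x∈as
  ...   | as₁ , as₂ , refl with splits-complete xs (dropₗ as₁ as₂ bs p)
  ...     | a , b , ab∈ , as↭a , bs↭b = x ∷ a , b , ∈-splits⁺ˡ x xs ab∈ , ↭-trans (shift x as₁ as₂) (prep x as↭a) , bs↭b
  splits-complete (x ∷ xs) {as} {bs} p | inj₂ x∈bs with ∈-∃++ x∈bs
  ...   | bs₁ , bs₂ , refl with splits-complete xs (dropᵣ as bs₁ bs₂ p)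
  ...     | a , b , ab∈ , as↭a , bs↭b = a , x ∷ b , ∈-splits⁺ʳ x xs ab∈ , as↭a , ↭-trans (shift x bs₁ bs₂) (prep x bs↭b)

  splits-injective : ∀ {xs : List A} {a b a′ b′} → Unique xs → (a , b) ∈ splits xs → (a′ , b′) ∈ splits xs →
                     a ↭ a′ → (a , b) ≡ (a′ , b′)
  splits-injective {xs = []} _ (here refl) (here refl) _ = refl
  splits-injective {xs = x ∷ xs} (x∉ ∷ !xs) ab∈ ab∈′ a↭a′ with ∈-splits⁻ x xs ab∈ | ∈-splits⁻ x xs ab∈′
  ... | inj₁ (_ , refl , p) | inj₁ (_ , refl , p′) =
    cong (Product.map₁ (x ∷_)) (splits-injective !xs p p′ (drop-∷ a↭a′))
  ... | inj₁ (_ , refl , p) | inj₂ (_ , refl , p′) =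
    ⊥-elim (All.lookup x∉ (splits-⊆ˡ xs p′ (∈-resp-↭ a↭a′ (here refl))) refl)
  ... | inj₂ (_ , refl , p) | inj₁ (_ , refl , p′) =
    ⊥-elim (All.lookup x∉ (splits-⊆ˡ xs p (∈-resp-↭ (↭-sym a↭a′) (here refl))) refl)
  ... | inj₂ (_ , refl , p) | inj₂ (_ , refl , p′) with splits-injective !xs p p′ a↭a′
  ...   | refl = refl

  Unique-splits : ∀ {xs : List A} → Unique xs → Unique (splits xs)
  Unique-splits {xs = []}     []         = [] ∷ []
  Unique-splits {A = A} {xs = x ∷ xs} (x∉ ∷ !xs) =
    ++⁺ (map⁺ map₁-injective (Unique-splits !xs)) (map⁺ map₂-injective (Unique-splits !xs))
        disjoint
    where
    map₁-injective : ∀ {ab ab′ : List A × List A} → Product.map₁ (x ∷_) ab ≡ Product.map₁ (x ∷_) ab′ → ab ≡ ab′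
    map₁-injective {_ , _} {_ , _} refl = refl
    map₂-injective : ∀ {ab ab′ : List A × List A} → Product.map₂ (x ∷_) ab ≡ Product.map₂ (x ∷_) ab′ → ab ≡ ab′
    map₂-injective {_ , _} {_ , _} refl = refl
    disjoint : Disjoint (map (Product.map₁ (x ∷_)) (splits xs)) (map (Product.map₂ (x ∷_)) (splits xs))
    disjoint (v∈ˡ , v∈ʳ) with ∈-map⁻ _ v∈ˡ | ∈-map⁻ _ v∈ʳ
    ... | _ , _ , refl | _ , p , v≡ = All.lookup x∉ (splits-⊆ˡ xs p (≡.subst (x ∈_) (cong proj₁ v≡) (here refl))) refl

  ++-∷-injective : ∀ {x : A} {σ σ′ τ τ′} → x ∉ σ → x ∉ σ′ → σ ++ x ∷ τ ≡ σ′ ++ x ∷ τ′ → σ ≡ σ′ × τ ≡ τ′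
  ++-∷-injective {σ = []}    {[]}      _   _    refl = refl , refl
  ++-∷-injective {σ = []}    {_ ∷ _}   _   x∉σ′ refl = ⊥-elim (x∉σ′ (here refl))
  ++-∷-injective {σ = _ ∷ _} {[]}      x∉σ _    refl = ⊥-elim (x∉σ (here refl))
  ++-∷-injective {σ = _ ∷ _} {_ ∷ _}   x∉σ x∉σ′ eq with ∷-injective eq
  ... | refl , eq′ with ++-∷-injective (x∉σ ∘ there) (x∉σ′ ∘ there) eq′
  ...   | refl , refl = refl , refl

  -- The fuel f must be at least length xs for this to list all permutations of xs.
  arrangements : ℕ → List A → List (List A)
  arrangementsAround : ℕ → A → List A × List A → List (List A)

  arrangements zero    _        = [] ∷ []
  arrangements (suc f) []       = [] ∷ []
  arrangements (suc f) (x ∷ xs) = concatMap (arrangementsAround f x) (splits xs)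

  arrangementsAround f x (a , b) = cartesianProductWith (λ σ τ → σ ++ x ∷ τ) (arrangements f a) (arrangements f b)

  ∈-arrangements⁻ : ∀ f (x : A) xs {w} → w ∈ arrangements (suc f) (x ∷ xs) →
                    ∃₂ λ a b → (a , b) ∈ splits xs × ∃₂ λ σ τ →
                      σ ∈ arrangements f a × τ ∈ arrangements f b × w ≡ σ ++ x ∷ τ
  ∈-arrangements⁻ f x xs w∈ with find (∈-concatMap⁻ (arrangementsAround f x) w∈)
  ... | (a , b) , ab∈ , w∈′ with ∈-cartesianProductWith⁻ _ (arrangements f a) (arrangements f b) w∈′
  ...   | σ , τ , σ∈ , τ∈ , refl = a , b , ab∈ , σ , τ , σ∈ , τ∈ , refl

  ∈-arrangements⁺ : ∀ f (x : A) xs {a b σ τ} → (a , b) ∈ splits xs →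
                    σ ∈ arrangements f a → τ ∈ arrangements f b → σ ++ x ∷ τ ∈ arrangements (suc f) (x ∷ xs)
  ∈-arrangements⁺ f x xs ab∈ σ∈ τ∈ = ∈-concatMap⁺ (arrangementsAround f x) (lose ab∈ (∈-cartesianProductWith⁺ _ σ∈ τ∈))

  private
    splits-length≤ : ∀ (xs : List A) {f a b} → (a , b) ∈ splits xs → length xs ≤ f → length a ≤ f × length b ≤ f
    splits-length≤ xs {a = a} {b} ab∈ xs≤f rewrite ≡.sym (splits-length xs ab∈) =
      ≤-trans (m≤m+n (length a) (length b)) xs≤f , ≤-trans (m≤n+m (length b) (length a)) xs≤f

  arrangements-↭ : ∀ f (xs : List A) {w} → length xs ≤ f → w ∈ arrangements f xs → w ↭ xs
  arrangements-↭ zero    []       _          (here refl) = ↭-refl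
  arrangements-↭ (suc f) []       _          (here refl) = ↭-refl
  arrangements-↭ (suc f) (x ∷ xs) (s≤s xs≤f) w∈ with ∈-arrangements⁻ f x xs w∈
  ... | a , b , ab∈ , σ , τ , σ∈ , τ∈ , refl =
    ↭-trans (shift x σ τ) (prep x (↭-trans
      (++⁺-↭ (arrangements-↭ f a (proj₁ ab≤f) σ∈) (arrangements-↭ f b (proj₂ ab≤f) τ∈))
      (splits-↭ xs ab∈)))
    where ab≤f = splits-length≤ xs ab∈ xs≤f

  ↭-arrangements : ∀ f (xs : List A) {w} → length xs ≤ f → w ↭ xs → w ∈ arrangements f xs
  ↭-arrangements zero    [] _ w↭ rewrite ↭-empty-inv w↭ = here refl
  ↭-arrangements (suc f) [] _ w↭ rewrite ↭-empty-inv w↭ = here refl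
  ↭-arrangements (suc f) (x ∷ xs) {w} (s≤s xs≤f) w↭ with ∈-∃++ (∈-resp-↭ (↭-sym w↭) (here refl))
  ... | σ , τ , refl with splits-complete xs (drop-mid σ [] w↭)
  ...   | a , b , ab∈ , σ↭a , τ↭b = ∈-arrangements⁺ f x xs ab∈
    (↭-arrangements f a (proj₁ ab≤f) σ↭a) (↭-arrangements f b (proj₂ ab≤f) τ↭b)
    where ab≤f = splits-length≤ xs ab∈ xs≤f

  Unique-arrangements : ∀ f (xs : List A) → length xs ≤ f → Unique xs → Unique (arrangements f xs)
  Unique-arrangements zero    []       _          _          = [] ∷ []
  Unique-arrangements (suc f) []       _          _          = [] ∷ []
  Unique-arrangements (suc f) (x ∷ xs) (s≤s xs≤f) (x∉ ∷ !xs) =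
    Unique-concatMap (Unique-splits !xs) unique-around disjoint-around
    where
    x∉ₗ : ∀ {a b σ} → (a , b) ∈ splits xs → σ ∈ arrangements f a → x ∉ σ
    x∉ₗ ab∈ σ∈ x∈σ = All.lookup x∉
      (splits-⊆ˡ xs ab∈ (∈-resp-↭ (arrangements-↭ f _ (proj₁ (splits-length≤ xs ab∈ xs≤f)) σ∈) x∈σ)) refl
    unique-around : ∀ {ab} → ab ∈ splits xs → Unique (arrangementsAround f x ab)
    unique-around {a , b} ab∈ = Unique-cartesianProductWith _
      (λ σ∈ σ′∈ → ++-∷-injective (x∉ₗ ab∈ σ∈) (x∉ₗ ab∈ σ′∈))
      (Unique-arrangements f a (proj₁ ab≤f) (proj₁ (splits-AllPairs !xs ab∈)))
      (Unique-arrangements f b (proj₂ ab≤f) (proj₂ (splits-AllPairs !xs ab∈)))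
      where ab≤f = splits-length≤ xs ab∈ xs≤f
    disjoint-around : ∀ {ab ab′ w} → ab ∈ splits xs → ab′ ∈ splits xs →
                      w ∈ arrangementsAround f x ab → w ∈ arrangementsAround f x ab′ → ab ≡ ab′
    disjoint-around {a , b} {a′ , b′} ab∈ ab∈′ w∈ w∈′
      with ∈-cartesianProductWith⁻ _ (arrangements f a) (arrangements f b) w∈
         | ∈-cartesianProductWith⁻ _ (arrangements f a′) (arrangements f b′) w∈′
    ... | σ , τ , σ∈ , _ , refl | σ′ , τ′ , σ∈′ , _ , eq
      with ++-∷-injective (x∉ₗ ab∈ σ∈) (x∉ₗ ab∈′ σ∈′) eq
    ... | refl , refl = splits-injective !xs ab∈ ab∈′ (↭-trans (↭-sym (σ↭ ab∈ σ∈)) (σ↭ ab∈′ σ∈′))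
      where
      σ↭ : ∀ {a b σ} → (a , b) ∈ splits xs → σ ∈ arrangements f a → σ ↭ a
      σ↭ ab∈ σ∈ = arrangements-↭ f _ (proj₁ (splits-length≤ xs ab∈ xs≤f)) σ∈

module Counting where

  open import Data.Bool.Base using (Bool; true; false; _∧_; if_then_else_)
  open import Data.Bool.Properties using (∧-zeroʳ)
  open import Data.Empty using (⊥-elim)
  open import Data.List.Base using (List; []; _∷_; _++_; length; map; cartesianProductWith)
  open import Data.List.Properties using (map-∘)
  open import Data.List.Membership.Propositional using (_∈_)
  open import Data.List.Relation.Unary.Any using (here; there)
  open import Data.Nat.Base using (ℕ; zero; suc; _+_; _*_; _∸_; _≤_; _<_; _≡ᵇ_; z≤n)
  open import Data.Nat.Properties as ℕ using (_≟_; _≤?_)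
  open import Data.Nat.Combinatorics using (_C_; nCk+nC[k+1]≡[n+1]C[k+1]; k>n⇒nCk≡0)
  open import Data.Nat.ListAction using (sum)
  open import Data.Product.Base as Product using (_×_; proj₁; proj₂)
  open import Algebra.Properties.CommutativeSemigroup ℕ.+-commutativeSemigroup using (x∙yz≈y∙xz)
  open import Function.Base using (_∘_)
  open import Level using (Level)
  open import Relation.Binary.PropositionalEquality as ≡ using (_≡_; _≢_; refl; cong; cong₂; module ≡-Reasoning)
  open import Relation.Nullary.Decidable using (yes; no)

  open ListLemmas
  open Arrangements using (splits)
  open Series using (module Sums)
  open Sums ℕ.+-*-commutativeSemiring public using (∑≤; ∑-cong; ∑-congᵉ; ∑-zero; ∑-distrib-+; ∑-suc)

  private variable
    a : Level
    A B Z : Set a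

  ind : Bool → ℕ
  ind b = if b then 1 else 0

  count-∷ : ∀ (p : A → Bool) x xs → count p (x ∷ xs) ≡ ind (p x) + count p xs
  count-∷ p x xs with p x
  ... | true  = refl
  ... | false = refl

  private
    ≡ᵇ-≢ : ∀ {m n} → m ≢ n → (m ≡ᵇ n) ≡ false
    ≡ᵇ-≢ {m} {n} m≢n with m ≡ᵇ n | ℕ.≡ᵇ⇒≡ m n
    ... | true  | to = ⊥-elim (m≢n (to _))
    ... | false | _  = refl

    ≡ᵇ-refl : ∀ m → (m ≡ᵇ m) ≡ true
    ≡ᵇ-refl m with m ≡ᵇ m | ℕ.≡⇒≡ᵇ m m
    ... | true  | _    = refl
    ... | false | from = ⊥-elim (from refl)

    +-≡ᵇ-∸ : ∀ {a k} s → a ≤ k → (a + s ≡ᵇ k) ≡ (s ≡ᵇ k ∸ a)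
    +-≡ᵇ-∸ {a} {k} s a≤k with s ≟ k ∸ a
    ... | yes refl = ≡.trans (cong (_≡ᵇ k) (ℕ.m+[n∸m]≡n a≤k)) (≡.trans (≡ᵇ-refl k) (≡.sym (≡ᵇ-refl (k ∸ a))))
    ... | no  s≢   = ≡.trans (≡ᵇ-≢ λ a+s≡k → s≢ (≡.trans (≡.sym (ℕ.m+n∸m≡n a s)) (cong (_∸ a) a+s≡k)))
                             (≡.sym (≡ᵇ-≢ s≢))

    +-≡ᵇ-> : ∀ {a k} s → k < a → (a + s ≡ᵇ k) ≡ false
    +-≡ᵇ-> {a} s k<a = ≡ᵇ-≢ λ a+s≡k → ℕ.<-irrefl (≡.sym a+s≡k) (ℕ.<-≤-trans k<a (ℕ.m≤m+n a s))

  ∑-δ-out : ∀ {a} k (g : ℕ → ℕ) → k < a → ∑≤ k (λ j → ind (a ≡ᵇ j) * g j) ≡ 0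
  ∑-δ-out {a} k g k<a = ∑-zero k λ j j≤k →
    cong (λ b → ind b * g j) (≡ᵇ-≢ {a} {j} λ { refl → ℕ.<-irrefl refl (ℕ.<-≤-trans k<a j≤k) })

  ∑-δ-in : ∀ {a} k (g : ℕ → ℕ) → a ≤ k → ∑≤ k (λ j → ind (a ≡ᵇ j) * g j) ≡ g a
  ∑-δ-in zero g z≤n = ℕ.+-identityʳ (g 0)
  ∑-δ-in {a} (suc k) g a≤ with a ≟ suc k
  ... | yes refl rewrite ≡ᵇ-refl (suc k) = cong₂ _+_ (∑-δ-out k g (ℕ.n<1+n k)) (ℕ.+-identityʳ (g (suc k)))
  ... | no  a≢   rewrite ≡ᵇ-≢ a≢ = ≡.trans (ℕ.+-identityʳ _) (∑-δ-in k g (ℕ.≤-pred (ℕ.≤∧≢⇒< a≤ a≢)))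

  countStat : (A → Bool) → (A → ℕ) → List A → ℕ → ℕ
  countStat p s xs l = count (λ x → p x ∧ (s x ≡ᵇ l)) xs

  count-shifted : ∀ (p : B → Bool) (s : B → ℕ) ys b a k →
                  count (λ y → (b ∧ p y) ∧ (a + s y ≡ᵇ k)) ys ≡
                  ∑≤ k (λ j → ind (b ∧ (a ≡ᵇ j)) * countStat p s ys (k ∸ j))
  count-shifted p s ys false a k = ≡.trans (count-false ys) (≡.sym (∑-zero k λ _ _ → refl))
  count-shifted p s ys true  a k with a ≤? k
  ... | yes a≤k = ≡.trans (count-cong ys λ {y} _ → cong (p y ∧_) (+-≡ᵇ-∸ (s y) a≤k))
                          (≡.sym (∑-δ-in k (countStat p s ys ∘ (k ∸_)) a≤k))
  ... | no  a≰k = ≡.trans (count-cong ys λ {y} _ → ≡.trans (cong (p y ∧_) (+-≡ᵇ-> (s y) k<a)) (∧-zeroʳ (p y)))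
                          (≡.trans (count-false ys) (≡.sym (∑-δ-out k (countStat p s ys ∘ (k ∸_)) k<a)))
    where k<a = ℕ.≰⇒> a≰k

  count-cartesianProductWith :
    ∀ (f : A → B → Z) (P : Z → Bool) (p : A → Bool) (s : A → ℕ) (q : B → Bool) (t : B → ℕ) xs ys k →
    (∀ {x y} → x ∈ xs → y ∈ ys → P (f x y) ≡ (p x ∧ q y) ∧ (s x + t y ≡ᵇ k)) →
    count P (cartesianProductWith f xs ys) ≡ ∑≤ k (λ j → countStat p s xs j * countStat q t ys (k ∸ j))
  count-cartesianProductWith f P p s q t []       ys k _   = ≡.sym (∑-zero k λ _ _ → refl)
  count-cartesianProductWith f P p s q t (x ∷ xs) ys k P≡ = begin
    count P (map (f x) ys ++ cartesianProductWith f xs ys)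
      ≡⟨ count-++ P (map (f x) ys) _ ⟩
    count P (map (f x) ys) + count P (cartesianProductWith f xs ys)
      ≡⟨ cong₂ _+_ (≡.trans (count-map P (f x) ys) (count-cong ys (P≡ (here refl))))
                   (count-cartesianProductWith f P p s q t xs ys k (P≡ ∘ there)) ⟩
    count (λ y → (p x ∧ q y) ∧ (s x + t y ≡ᵇ k)) ys + ∑≤ k (λ j → countStat p s xs j * countStat q t ys (k ∸ j))
      ≡⟨ cong (_+ _) (count-shifted q t ys (p x) (s x) k) ⟩
    ∑≤ k (λ j → ind (p x ∧ (s x ≡ᵇ j)) * countStat q t ys (k ∸ j)) + ∑≤ k (λ j → countStat p s xs j * countStat q t ys (k ∸ j))
      ≡⟨ ∑-distrib-+ k _ _ ⟨
    ∑≤ k (λ j → ind (p x ∧ (s x ≡ᵇ j)) * countStat q t ys (k ∸ j) + countStat p s xs j * countStat q t ys (k ∸ j))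
      ≡⟨ ∑-congᵉ k (λ j → ≡.trans (≡.sym (ℕ.*-distribʳ-+ _ (ind (p x ∧ (s x ≡ᵇ j))) _))
                                   (cong (_* countStat q t ys (k ∸ j)) (≡.sym (count-∷ (λ x → p x ∧ (s x ≡ᵇ j)) x xs)))) ⟩
    ∑≤ k (λ j → countStat p s (x ∷ xs) j * countStat q t ys (k ∸ j)) ∎
    where open ≡-Reasoning

  ∑-pascal : ∀ n (Ψ : ℕ → ℕ → ℕ) →
             ∑≤ n (λ i → (n C i) * Ψ (suc i) (n ∸ i)) + ∑≤ n (λ i → (n C i) * Ψ i (suc (n ∸ i))) ≡
             ∑≤ (suc n) (λ i → (suc n C i) * Ψ i (suc n ∸ i))
  ∑-pascal n Ψ = begin
    L + ∑≤ n (λ i → (n C i) * Ψ i (suc (n ∸ i)))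
      ≡⟨ cong (L +_) shifted ⟩
    L + (1 * Ψ 0 (suc n) + R)
      ≡⟨ x∙yz≈y∙xz L _ R ⟩
    1 * Ψ 0 (suc n) + (L + R)
      ≡⟨ cong (1 * Ψ 0 (suc n) +_) (∑-distrib-+ n _ _) ⟨
    1 * Ψ 0 (suc n) + ∑≤ n (λ i → (n C i) * Ψ (suc i) (n ∸ i) + (n C suc i) * Ψ (suc i) (n ∸ i))
      ≡⟨ cong (1 * Ψ 0 (suc n) +_) (∑-congᵉ n λ i →
           ≡.trans (≡.sym (ℕ.*-distribʳ-+ _ (n C i) _)) (cong (_* Ψ (suc i) (n ∸ i)) (nCk+nC[k+1]≡[n+1]C[k+1] n i))) ⟩
    1 * Ψ 0 (suc n) + ∑≤ n (λ i → (suc n C suc i) * Ψ (suc i) (n ∸ i))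
      ≡⟨ ∑-suc n _ ⟨
    ∑≤ (suc n) (λ i → (suc n C i) * Ψ i (suc n ∸ i)) ∎
    where
    open ≡-Reasoning
    L = ∑≤ n (λ i → (n C i) * Ψ (suc i) (n ∸ i))
    R = ∑≤ n (λ i → (n C suc i) * Ψ (suc i) (n ∸ i))
    shifted : ∑≤ n (λ i → (n C i) * Ψ i (suc (n ∸ i))) ≡ 1 * Ψ 0 (suc n) + R
    shifted = begin
      ∑≤ n (λ i → (n C i) * Ψ i (suc (n ∸ i)))
        ≡⟨ ∑-cong n (λ i i≤n → cong (λ m → (n C i) * Ψ i m) (ℕ.+-∸-assoc 1 i≤n)) ⟨
      ∑≤ n (λ i → (n C i) * Ψ i (suc n ∸ i))
        ≡⟨ ℕ.+-identityʳ _ ⟨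
      ∑≤ n (λ i → (n C i) * Ψ i (suc n ∸ i)) + 0
        ≡⟨ cong (λ c → ∑≤ n (λ i → (n C i) * Ψ i (suc n ∸ i)) + c * Ψ (suc n) (n ∸ n)) (k>n⇒nCk≡0 (ℕ.n<1+n n)) ⟨
      ∑≤ (suc n) (λ i → (n C i) * Ψ i (suc n ∸ i))
        ≡⟨ ∑-suc n _ ⟩
      1 * Ψ 0 (suc n) + R ∎

  ∑-splits : ∀ (xs : List A) (Ψ : ℕ → ℕ → ℕ) →
             sum (map (λ ab → Ψ (length (proj₁ ab)) (length (proj₂ ab))) (splits xs)) ≡
             ∑≤ (length xs) (λ i → (length xs C i) * Ψ i (length xs ∸ i))
  ∑-splits []       Ψ = refl
  ∑-splits (x ∷ xs) Ψ = begin
    sum (map h (map (Product.map₁ (x ∷_)) (splits xs) ++ map (Product.map₂ (x ∷_)) (splits xs)))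
      ≡⟨ sum-map-++ h (map (Product.map₁ (x ∷_)) (splits xs)) _ ⟩
    sum (map h (map (Product.map₁ (x ∷_)) (splits xs))) + sum (map h (map (Product.map₂ (x ∷_)) (splits xs)))
      ≡⟨ cong₂ _+_ (≡.trans (cong sum (≡.sym (map-∘ (splits xs)))) (∑-splits xs (λ i j → Ψ (suc i) j)))
                   (≡.trans (cong sum (≡.sym (map-∘ (splits xs)))) (∑-splits xs (λ i j → Ψ i (suc j)))) ⟩
    ∑≤ n (λ i → (n C i) * Ψ (suc i) (n ∸ i)) + ∑≤ n (λ i → (n C i) * Ψ i (suc (n ∸ i)))
      ≡⟨ ∑-pascal n Ψ ⟩
    ∑≤ (suc n) (λ i → (suc n C i) * Ψ i (suc n ∸ i)) ∎
    where
    open ≡-Reasoning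
    n = length xs
    h = λ (ab : List _ × List _) → Ψ (length (proj₁ ab)) (length (proj₂ ab))

module JacobiPermutations where

  open import Data.Bool.Base using (Bool; true; false; _∧_; T; if_then_else_)
  open import Data.Bool.Properties using (∧-assoc; ∧-zeroʳ; T-≡)
  open import Data.Empty using (⊥-elim)
  open import Data.List.Base using (List; []; _∷_; _++_; length; map; concatMap; upTo; applyUpTo)
  open import Data.List.Properties using (length-applyUpTo; ∷-injectiveˡ; ∷-injectiveʳ)
  open import Data.List.Membership.Propositional using (_∈_; find; lose)
  open import Data.List.Relation.Binary.Subset.Propositional using () renaming (_⊆_ to _⊆ₛ_)
  open import Data.List.Membership.Propositional.Properties
    using (∈-map⁺; ∈-map⁻; ∈-concatMap⁺; ∈-concatMap⁻; ∈-upTo⁺; ∈-upTo⁻; ∈-applyUpTo⁺; ∈-applyUpTo⁻; ∈-filter⁺; ∈-filter⁻)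
  open import Data.List.Relation.Binary.Permutation.Propositional using (_↭_; ↭-sym)
  open import Data.List.Relation.Binary.Permutation.Propositional.Properties using (↭-length; ∈-resp-↭)
  open import Data.List.Relation.Unary.All as All using (All; []; _∷_)
  open import Data.List.Relation.Unary.AllPairs as AllPairs using (AllPairs; []; _∷_)
  import Data.List.Relation.Unary.AllPairs.Properties as AllPairs
  open import Data.List.Relation.Unary.Any as Any using (here)
  open import Data.List.Relation.Unary.Any.Properties using (any⁺; any⁻)
  open import Data.List.Relation.Unary.Unique.Propositional using (Unique)
  import Data.List.Relation.Unary.Unique.Propositional.Properties as Unique
  open import Data.Nat.Base using (ℕ; zero; suc; _+_; _*_; _∸_; _≤_; _<_; _<ᵇ_; _≡ᵇ_; s≤s)
  open import Data.Nat.Properties as ℕ using (_≟_)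
  open import Data.Nat.Combinatorics using (_C_)
  open import Data.Nat.ListAction using (sum)
  open import Data.Product.Base using (_×_; _,_; proj₁; proj₂)
  open import Data.Unit.Base using (tt)
  open import Function.Base using (_∘_)
  open import Function.Bundles using (Equivalence)
  open import Relation.Binary.PropositionalEquality as ≡ using (_≡_; refl; cong; cong₂; module ≡-Reasoning)

  open ListLemmas
  open Arrangements
  open Counting

  range : ℕ → List ℕ
  range n = applyUpTo suc n

  Unique-range : ∀ n → Unique (range n)
  Unique-range n = Unique.applyUpTo⁺₁ suc n λ i<j _ → ℕ.<⇒≢ (s≤s i<j)

  sorted-range : ∀ n → AllPairs _<_ (range n)
  sorted-range n = AllPairs.applyUpTo⁺₁ suc n λ i<j _ → s≤s i<j

  T-elemᵇ⇒∈ : ∀ a w → T (elemᵇ a w) → a ∈ w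
  T-elemᵇ⇒∈ a w = Any.map (ℕ.≡ᵇ⇒≡ a _) ∘ any⁻ _ w

  ∈⇒T-elemᵇ : ∀ {a w} → a ∈ w → T (elemᵇ a w)
  ∈⇒T-elemᵇ {a} = any⁺ _ ∘ Any.map λ { refl → ℕ.≡⇒≡ᵇ a a refl }

  T-distinctᵇ⇒Unique : ∀ w → T (distinctᵇ w) → Unique w
  T-distinctᵇ⇒Unique []      _ = []
  T-distinctᵇ⇒Unique (a ∷ w) t with elemᵇ a w | ∈⇒T-elemᵇ {a} {w}
  ... | false | a∉w = All.tabulate (λ { b∈w refl → a∉w b∈w }) ∷ T-distinctᵇ⇒Unique w t

  Unique⇒T-distinctᵇ : ∀ {w} → Unique w → T (distinctᵇ w)
  Unique⇒T-distinctᵇ {[]}    []         = tt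
  Unique⇒T-distinctᵇ {a ∷ w} (a∉ ∷ !w) with elemᵇ a w | T-elemᵇ⇒∈ a w
  ... | true  | a∈w = ⊥-elim (All.lookup a∉ (a∈w tt) refl)
  ... | false | _   = Unique⇒T-distinctᵇ !w

  ∈-words⁻ : ∀ m n {w} → w ∈ words m n → length w ≡ m × All (_∈ range n) w
  ∈-words⁻ zero    n (here refl) = refl , []
  ∈-words⁻ (suc m) n w∈ with find (∈-concatMap⁻ _ w∈)
  ... | w′ , w′∈ , w∈′ with ∈-map⁻ _ w∈′ | ∈-words⁻ m n w′∈
  ... | a , a∈ , refl | refl , w′⊆ = refl , ∈-applyUpTo⁺ suc (∈-upTo⁻ a∈) ∷ w′⊆

  ∈-words⁺ : ∀ m n {w} → length w ≡ m → All (_∈ range n) w → w ∈ words m n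
  ∈-words⁺ zero    n {[]}    refl []         = here refl
  ∈-words⁺ (suc m) n {b ∷ w} refl (b∈ ∷ w⊆) with ∈-applyUpTo⁻ suc b∈
  ... | i , i<n , refl = ∈-concatMap⁺ _ (lose (∈-words⁺ m n refl w⊆) (∈-map⁺ _ (∈-upTo⁺ i<n)))

  Unique-words : ∀ m n → Unique (words m n)
  Unique-words zero    n = [] ∷ []
  Unique-words (suc m) n = Unique-concatMap (Unique-words m n)
    (λ _ → Unique.map⁺ (ℕ.suc-injective ∘ ∷-injectiveˡ) (Unique.upTo⁺ n))
    λ _ _ → same-tail
    where
    same-tail : ∀ {v w w′} → v ∈ map (λ a → suc a ∷ w) (upTo n) → v ∈ map (λ a → suc a ∷ w′) (upTo n) → w ≡ w′
    same-tail v∈ v∈′ with ∈-map⁻ _ v∈ | ∈-map⁻ _ v∈′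
    ... | _ , _ , refl | _ , _ , v≡ = ∷-injectiveʳ v≡

  Unique-perms : ∀ n → Unique (perms n)
  Unique-perms n = Unique.filter⁺ _ (Unique-words n n)

  ∈-perms⁻ : ∀ n {w} → w ∈ perms n → w ↭ range n
  ∈-perms⁻ n w∈ with ∈-filter⁻ _ w∈
  ... | w∈words , distinct with ∈-words⁻ n n w∈words
  ... | length≡ , w⊆ = Unique∧⊇⇒↭ !w (Unique-range n) (All.lookup w⊆)
    (Unique⊆∧length≥⇒⊇ _≟_ !w (All.lookup w⊆) (ℕ.≤-reflexive (≡.trans (length-applyUpTo suc n) (≡.sym length≡))))
    where !w = T-distinctᵇ⇒Unique _ distinct

  ∈-perms⁺ : ∀ n {w} → w ↭ range n → w ∈ perms n
  ∈-perms⁺ n w↭ = ∈-filter⁺ _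
    (∈-words⁺ n n (≡.trans (↭-length w↭) (length-applyUpTo suc n)) (All.tabulate (∈-resp-↭ w↭)))
    (Unique⇒T-distinctᵇ (Unique-resp-↭ (↭-sym w↭) (Unique-range n)))

  perms↭arrangements : ∀ n → perms n ↭ arrangements n (range n)
  perms↭arrangements n = Unique∧⊇⇒↭ (Unique-perms n) (Unique-arrangements n (range n) range≤n (Unique-range n))
    (↭-arrangements n (range n) range≤n ∘ ∈-perms⁻ n)
    (∈-perms⁺ n ∘ arrangements-↭ n (range n) range≤n)
    where range≤n = ℕ.≤-reflexive (length-applyUpTo suc n)

  private
    <ᵇ-true : ∀ {m n} → m < n → (m <ᵇ n) ≡ true
    <ᵇ-true m<n = Equivalence.to T-≡ (ℕ.<⇒<ᵇ m<n)

    <ᵇ-false : ∀ {m n} → n < m → (m <ᵇ n) ≡ false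
    <ᵇ-false {m} {n} n<m with m <ᵇ n | ℕ.<ᵇ⇒< m n
    ... | true  | to = ⊥-elim (ℕ.<-asym n<m (to tt))
    ... | false | _  = refl

  ρlen-stop : ∀ {x m} σ τ → m < x → ρlen x (σ ++ m ∷ τ) ≡ ρlen x σ
  ρlen-stop {x} []      τ m<x rewrite <ᵇ-false m<x = refl
  ρlen-stop {x} (y ∷ σ) τ m<x with x <ᵇ y
  ... | true  = cong suc (ρlen-stop σ τ m<x)
  ... | false = refl

  ρlen-all : ∀ {m} τ → All (m <_) τ → ρlen m τ ≡ length τ
  ρlen-all []      []           = refl
  ρlen-all (y ∷ τ) (m<y ∷ m<τ) rewrite <ᵇ-true m<y = cong suc (ρlen-all τ m<τ)

  -- Splitting at the minimum m: the runs ρ of letters left of m stop at m, and ρ(m) is all of τ.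
  isJacobi-split : ∀ {m} σ τ → All (m <_) σ → All (m <_) τ →
                   isJacobiᵇ (σ ++ m ∷ τ) ≡ isJacobiᵇ σ ∧ (evenᵇ (length τ) ∧ isJacobiᵇ τ)
  isJacobi-split []      τ []          m<τ rewrite ρlen-all τ m<τ = refl
  isJacobi-split (x ∷ σ) τ (m<x ∷ m<σ) m<τ rewrite ρlen-stop σ τ m<x | isJacobi-split σ τ m<σ m<τ =
    ≡.sym (∧-assoc (evenᵇ (ρlen x σ)) (isJacobiᵇ σ) _)

  asc-split : ∀ {m} σ τ → All (m <_) σ → asc (σ ++ m ∷ τ) ≡ asc σ + asc (m ∷ τ)
  asc-split []          τ _               = refl
  asc-split (x ∷ [])    τ (m<x ∷ _)       rewrite <ᵇ-false m<x = refl
  asc-split (x ∷ y ∷ σ) τ (_ ∷ m<y∷σ) =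
    ≡.trans (cong ((if x <ᵇ y then 1 else 0) +_) (asc-split (y ∷ σ) τ m<y∷σ))
            (≡.sym (ℕ.+-assoc (if x <ᵇ y then 1 else 0) _ _))

  asc-∷-min : ∀ {m y} τ → m < y → asc (m ∷ y ∷ τ) ≡ suc (asc (y ∷ τ))
  asc-∷-min τ m<y rewrite <ᵇ-true m<y = refl

  jacobiWithAsc : ℕ → List ℕ → Bool
  jacobiWithAsc k π = isJacobiᵇ π ∧ (asc π ≡ᵇ k)

  -- For a j-set above m: the number of arrangements τ with |τ| even, τ Jacobi and asc (m ∷ τ) = l.
  tailCount : ℕ → ℕ → ℕ
  tailCount zero    zero    = 1
  tailCount zero    (suc l) = 0
  tailCount (suc j) zero    = 0
  tailCount (suc j) (suc l) = if evenᵇ (suc j) then jacobiCount (suc j) l else 0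

  splitCount : ℕ → ℕ → ℕ → ℕ
  splitCount k i j = ∑≤ k (λ l → jacobiCount i l * tailCount j (k ∸ l))

  JacobiCounted : ℕ → List ℕ → Set
  JacobiCounted f A = ∀ k → count (jacobiWithAsc k) (arrangements f A) ≡ jacobiCount (length A) k

  arrangements-[] : ∀ f → arrangements {A = ℕ} f [] ≡ [] ∷ []
  arrangements-[] zero    = refl
  arrangements-[] (suc f) = refl

  count-tails : ∀ f {m} B → length B ≤ f → All (m <_) B → JacobiCounted f B → ∀ l →
                countStat (λ τ → evenᵇ (length τ) ∧ isJacobiᵇ τ) (λ τ → asc (m ∷ τ)) (arrangements f B) l ≡
                tailCount (length B) l
  count-tails f []      _   _   _      zero    rewrite arrangements-[] f = refl
  count-tails f []      _   _   _      (suc l) rewrite arrangements-[] f = refl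
  count-tails f {m} (b ∷ B) B≤f m<B counted zero =
    ≡.trans (count-cong {q = λ _ → false} _ ascent-after-m) (count-false (arrangements f (b ∷ B)))
    where
    ascent-after-m : ∀ {τ} → τ ∈ arrangements f (b ∷ B) → ((evenᵇ (length τ) ∧ isJacobiᵇ τ) ∧ (asc (m ∷ τ) ≡ᵇ 0)) ≡ false
    ascent-after-m {[]}     τ∈ with () ← ↭-length (arrangements-↭ f (b ∷ B) B≤f τ∈)
    ascent-after-m {y ∷ τ′} τ∈
      rewrite asc-∷-min τ′ (All.lookup m<B (∈-resp-↭ (arrangements-↭ f (b ∷ B) B≤f τ∈) (here refl))) = ∧-zeroʳ _
  count-tails f {m} (b ∷ B) B≤f m<B counted (suc l) =
    ≡.trans (count-cong {q = λ τ → evenᵇ (suc (length B)) ∧ jacobiWithAsc l τ} _ regroup) (by-parity (evenᵇ (suc (length B))))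
    where
    regroup : ∀ {τ} → τ ∈ arrangements f (b ∷ B) →
              ((evenᵇ (length τ) ∧ isJacobiᵇ τ) ∧ (asc (m ∷ τ) ≡ᵇ suc l)) ≡ evenᵇ (suc (length B)) ∧ jacobiWithAsc l τ
    regroup {[]}     τ∈ with () ← ↭-length (arrangements-↭ f (b ∷ B) B≤f τ∈)
    regroup {y ∷ τ′} τ∈
      rewrite asc-∷-min τ′ (All.lookup m<B (∈-resp-↭ (arrangements-↭ f (b ∷ B) B≤f τ∈) (here refl)))
            | ↭-length (arrangements-↭ f (b ∷ B) B≤f τ∈) = ∧-assoc (evenᵇ (suc (length B))) (isJacobiᵇ (y ∷ τ′)) _
    by-parity : ∀ e → count (λ τ → e ∧ jacobiWithAsc l τ) (arrangements f (b ∷ B)) ≡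
                      (if e then jacobiCount (suc (length B)) l else 0)
    by-parity true  = counted l
    by-parity false = count-false (arrangements f (b ∷ B))

  count-arrangements-∷ : ∀ f {m} S → AllPairs _<_ (m ∷ S) → length S ≤ f →
                         (∀ {A} → AllPairs _<_ A → length A ≤ length S → JacobiCounted f A) → ∀ k →
                         count (jacobiWithAsc k) (arrangements (suc f) (m ∷ S)) ≡
                         ∑≤ (length S) (λ i → (length S C i) * splitCount k i (length S ∸ i))
  count-arrangements-∷ f {m} S (m<S ∷ sorted) S≤f counted k = begin
    count (jacobiWithAsc k) (concatMap (arrangementsAround f m) (splits S))
      ≡⟨ count-concatMap _ (arrangementsAround f m) (splits S) ⟩
    sum (map (count (jacobiWithAsc k) ∘ arrangementsAround f m) (splits S))
      ≡⟨ sum-map-cong (splits S) per-split ⟩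
    sum (map (λ ab → splitCount k (length (proj₁ ab)) (length (proj₂ ab))) (splits S))
      ≡⟨ ∑-splits S (splitCount k) ⟩
    ∑≤ (length S) (λ i → (length S C i) * splitCount k i (length S ∸ i)) ∎
    where
    open ≡-Reasoning
    per-split : ∀ {ab} → ab ∈ splits S →
                count (jacobiWithAsc k) (arrangementsAround f m ab) ≡ splitCount k (length (proj₁ ab)) (length (proj₂ ab))
    per-split {a , b} ab∈ = ≡.trans
      (count-cartesianProductWith _ (jacobiWithAsc k) isJacobiᵇ asc (λ τ → evenᵇ (length τ) ∧ isJacobiᵇ τ)
                                   (λ τ → asc (m ∷ τ)) (arrangements f a) (arrangements f b) k glued)
      (∑-congᵉ k λ j → cong₂ _*_ (counted (proj₁ (splits-AllPairs sorted ab∈)) a≤S j)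
                                (count-tails f b (ℕ.≤-trans b≤S S≤f) (All.tabulate (All.lookup m<S ∘ splits-⊆ʳ S ab∈))
                                             (counted (proj₂ (splits-AllPairs sorted ab∈)) b≤S) (k ∸ j)))
      where
      a≤S = ℕ.≤-trans (ℕ.m≤m+n (length a) (length b)) (ℕ.≤-reflexive (splits-length S ab∈))
      b≤S = ℕ.≤-trans (ℕ.m≤n+m (length b) (length a)) (ℕ.≤-reflexive (splits-length S ab∈))
      above-m : ∀ {c σ} → (c ⊆ₛ S) → length c ≤ f → σ ∈ arrangements f c → All (m <_) σ
      above-m c⊆S c≤f σ∈ = All.tabulate (All.lookup m<S ∘ c⊆S ∘ ∈-resp-↭ (arrangements-↭ f _ c≤f σ∈))
      glued : ∀ {σ τ} → σ ∈ arrangements f a → τ ∈ arrangements f b →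
              jacobiWithAsc k (σ ++ m ∷ τ) ≡ (isJacobiᵇ σ ∧ (evenᵇ (length τ) ∧ isJacobiᵇ τ)) ∧ (asc σ + asc (m ∷ τ) ≡ᵇ k)
      glued {σ} {τ} σ∈ τ∈
        rewrite isJacobi-split σ τ (above-m (splits-⊆ˡ S ab∈) (ℕ.≤-trans a≤S S≤f) σ∈)
                                   (above-m (splits-⊆ʳ S ab∈) (ℕ.≤-trans b≤S S≤f) τ∈)
              | asc-split σ τ (above-m (splits-⊆ˡ S ab∈) (ℕ.≤-trans a≤S S≤f) σ∈) = refl

  count-arrangements : ∀ N f A → AllPairs _<_ A → length A ≤ f → length A ≤ N → JacobiCounted f A
  jacobiCount-suc′ : ∀ N n → n ≤ N → ∀ k → jacobiCount (suc n) k ≡ ∑≤ n (λ i → (n C i) * splitCount k i (n ∸ i))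

  count-arrangements N       f       []      _      _          _          k rewrite arrangements-[] f = refl
  count-arrangements (suc N) (suc f) (m ∷ S) sorted (s≤s S≤f) (s≤s S≤N) k = ≡.trans
    (count-arrangements-∷ f S sorted S≤f (λ !A A≤S → count-arrangements N f _ !A (ℕ.≤-trans A≤S S≤f) (ℕ.≤-trans A≤S S≤N)) k)
    (≡.sym (jacobiCount-suc′ N (length S) S≤N k))

  jacobiCount-suc′ N n n≤N k = begin
    count (jacobiWithAsc k) (perms (suc n))
      ≡⟨ count-↭ _ (perms↭arrangements (suc n)) ⟩
    count (jacobiWithAsc k) (arrangements (suc n) (1 ∷ S))
      ≡⟨ count-arrangements-∷ n S (sorted-range (suc n)) (ℕ.≤-reflexive |S|≡n)
           (λ !A A≤S → count-arrangements N n _ !A (ℕ.≤-trans A≤S (ℕ.≤-reflexive |S|≡n))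
                                                    (ℕ.≤-trans A≤S (ℕ.≤-trans (ℕ.≤-reflexive |S|≡n) n≤N))) k ⟩
    ∑≤ (length S) (λ i → (length S C i) * splitCount k i (length S ∸ i))
      ≡⟨ cong (λ z → ∑≤ z (λ i → (z C i) * splitCount k i (z ∸ i))) |S|≡n ⟩
    ∑≤ n (λ i → (n C i) * splitCount k i (n ∸ i)) ∎
    where
    open ≡-Reasoning
    S = applyUpTo (suc ∘ suc) n
    |S|≡n = length-applyUpTo (suc ∘ suc) n

  -- Removing the letter 1 splits a Jacobi permutation of [n + 1] into two on complementary sets.
  jacobiCount-suc : ∀ n k → jacobiCount (suc n) k ≡ ∑≤ n (λ i → (n C i) * splitCount k i (n ∸ i))
  jacobiCount-suc n = jacobiCount-suc′ n n ℕ.≤-refl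

module ClosedForm where

  open import Algebra.Bundles using (CommutativeRing; RawRing)
  open import Algebra.Solver.Ring.AlmostCommutativeRing using (_-Raw-AlmostCommutative⟶_; fromCommutativeRing)
  open import Data.Integer.Base using (+_)
  open import Data.Maybe.Base using (Maybe; just; nothing)
  open import Data.Rational.Base using (0ℚ; 1ℚ; ½; _/_)
  open import Data.Rational.Properties using (+-*-commutativeRing) renaming (_≟_ to _≟ℚ_)
  open import Level using (0ℓ)
  import Relation.Binary.PropositionalEquality as ≡
  open import Relation.Nullary.Decidable using (yes; no)

  ℚ-rawRing : RawRing 0ℓ 0ℓ
  ℚ-rawRing = CommutativeRing.rawRing +-*-commutativeRing

  module ℚAlgebra (A : CommutativeRing 0ℓ 0ℓ)
                  (embed : ℚ-rawRing -Raw-AlmostCommutative⟶ fromCommutativeRing A) where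

    open CommutativeRing A
    open _-Raw-AlmostCommutative⟶_ embed using (⟦_⟧)
    open import Relation.Binary.Reasoning.Setoid setoid

    ≟-embed : ∀ p q → Maybe (⟦ p ⟧ ≈ ⟦ q ⟧)
    ≟-embed p q with p ≟ℚ q
    ... | yes ≡.refl = just refl
    ... | no _       = nothing

    open import Algebra.Solver.Ring ℚ-rawRing (fromCommutativeRing A) embed ≟-embed
      using (solve; _:=_; con; _:+_; _:*_; _:-_; :-_; Polynomial)

    one two half : Carrier
    one  = ⟦ 1ℚ ⟧
    two  = ⟦ + 2 / 1 ⟧
    half = ⟦ ½ ⟧

    den num : Carrier → Carrier → Carrier
    den ρ e = (one + ρ) + (ρ - one) * e
    num ρ e = (ρ - one) + (ρ + one) * e

    :den :num : ∀ {n} → Polynomial n → Polynomial n → Polynomial n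
    :den ρ e = (con 1ℚ :+ ρ) :+ (ρ :- con 1ℚ) :* e
    :num ρ e = (ρ :- con 1ℚ) :+ (ρ :+ con 1ℚ) :* e

    -- 1 + 2 (e - 1) / den, with d standing for 1 / den
    closedForm : Carrier → Carrier → Carrier
    closedForm e d = one + (two * (e - one)) * d

    cancel-unit² : ∀ {u v x y} → u * v ≈ one → x * v * v ≈ y * v * v → x ≈ y
    cancel-unit² {u} {v} {x} {y} uv≈1 xvv≈yvv = begin
      x                           ≈⟨ solve 1 (λ x → x := x :* (con 1ℚ :* con 1ℚ)) refl x ⟩
      x * (one * one)             ≈⟨ *-congˡ (*-cong (sym uv≈1) (sym uv≈1)) ⟩
      x * ((u * v) * (u * v))     ≈⟨ solve 3 (λ x u v → x :* ((u :* v) :* (u :* v)) := (x :* v :* v) :* (u :* u)) refl x u v ⟩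
      (x * v * v) * (u * u)       ≈⟨ *-congʳ xvv≈yvv ⟩
      (y * v * v) * (u * u)       ≈⟨ solve 3 (λ y u v → (y :* v :* v) :* (u :* u) := y :* ((u :* v) :* (u :* v))) refl y u v ⟩
      y * ((u * v) * (u * v))     ≈⟨ *-congˡ (*-cong uv≈1 uv≈1) ⟩
      y * (one * one)             ≈⟨ solve 1 (λ y → y :* (con 1ℚ :* con 1ℚ) := y) refl y ⟩
      y                           ∎

    closedForm≈num*d : ∀ {ρ e d} → d * den ρ e ≈ one → closedForm e d ≈ num ρ e * d
    closedForm≈num*d {ρ} {e} {d} d*den≈1 = begin
      one + (two * (e - one)) * d          ≈⟨ +-congʳ (sym d*den≈1) ⟩
      d * den ρ e + (two * (e - one)) * d  ≈⟨ solve 3 (λ ρ e d →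
        d :* :den ρ e :+ (con (+ 2 / 1) :* (e :- con 1ℚ)) :* d := :num ρ e :* d) refl ρ e d ⟩
      num ρ e * d                          ∎

    closedForm*den≈num : ∀ {ρ e d} → d * den ρ e ≈ one → closedForm e d * den ρ e ≈ num ρ e
    closedForm*den≈num {ρ} {e} {d} d*den≈1 = begin
      closedForm e d * den ρ e   ≈⟨ *-congʳ (closedForm≈num*d d*den≈1) ⟩
      num ρ e * d * den ρ e      ≈⟨ *-assoc _ _ _ ⟩
      num ρ e * (d * den ρ e)    ≈⟨ *-congˡ d*den≈1 ⟩
      num ρ e * one              ≈⟨ solve 1 (λ n → n :* con 1ℚ := n) refl (num ρ e) ⟩
      num ρ e                    ∎

    -- Replacing e by 1/e exchanges num and den, up to the factor e.
    *-num-inverse : ∀ {ρ e f} → f * e ≈ one → e * num ρ f ≈ den ρ e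
    *-num-inverse {ρ} {e} {f} fe≈1 = begin
      e * num ρ f                               ≈⟨ solve 3 (λ ρ e f →
        e :* :num ρ f := e :* (ρ :- con 1ℚ) :+ (ρ :+ con 1ℚ) :* (f :* e)) refl ρ e f ⟩
      e * (ρ - one) + (ρ + one) * (f * e)       ≈⟨ +-congˡ (*-congˡ fe≈1) ⟩
      e * (ρ - one) + (ρ + one) * one           ≈⟨ solve 2 (λ ρ e →
        e :* (ρ :- con 1ℚ) :+ (ρ :+ con 1ℚ) :* con 1ℚ := :den ρ e) refl ρ e ⟩
      den ρ e                                   ∎

    closedForm-reciprocal : ∀ {ρ e f d d′} → f * e ≈ one → d * den ρ e ≈ one → d′ * den ρ f ≈ one →
                            closedForm e d * closedForm f d′ ≈ one
    closedForm-reciprocal {ρ} {e} {f} {d} {d′} fe≈1 d*den≈1 d′*den≈1 = begin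
      closedForm e d * closedForm f d′
        ≈⟨ *-cong (closedForm≈num*d d*den≈1) (closedForm≈num*d d′*den≈1) ⟩
      (num ρ e * d) * (num ρ f * d′)
        ≈⟨ solve 1 (λ x → x := con 1ℚ :* x) refl _ ⟩
      one * ((num ρ e * d) * (num ρ f * d′))
        ≈⟨ *-congʳ (sym fe≈1) ⟩
      (f * e) * ((num ρ e * d) * (num ρ f * d′))
        ≈⟨ solve 6 (λ f e ne nf d d′ → (f :* e) :* ((ne :* d) :* (nf :* d′)) := (e :* nf) :* (f :* ne) :* (d :* d′))
                   refl f e (num ρ e) (num ρ f) d d′ ⟩
      (e * num ρ f) * (f * num ρ e) * (d * d′)
        ≈⟨ *-congʳ (*-cong (*-num-inverse fe≈1) (*-num-inverse (trans (*-comm e f) fe≈1))) ⟩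
      den ρ e * den ρ f * (d * d′)
        ≈⟨ solve 4 (λ a b d d′ → a :* b :* (d :* d′) := (d :* a) :* (d′ :* b)) refl (den ρ e) (den ρ f) d d′ ⟩
      (d * den ρ e) * (d′ * den ρ f)
        ≈⟨ *-cong d*den≈1 d′*den≈1 ⟩
      one * one
        ≈⟨ solve 0 (con 1ℚ :* con 1ℚ := con 1ℚ) refl ⟩
      one ∎

    -- For E the even part of R and R′ = 1/R its reflection, T R E = T (R² + 1)/2.
    riccati⇒ode : ∀ {T R R′ E X} → R * R′ ≈ one → E + E ≈ R + R′ →
                  X ≈ R - T * R + half * (T * (R * R + one)) → X ≈ R * ((one - T) + T * E)
    riccati⇒ode {T} {R} {R′} {E} {X} RR′≈1 E+E≈R+R′ X≈ = begin
      X                                              ≈⟨ X≈ ⟩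
      R - T * R + half * (T * (R * R + one))         ≈⟨ +-congˡ (*-congˡ (*-congˡ (+-congˡ (sym RR′≈1)))) ⟩
      R - T * R + half * (T * (R * R + R * R′))      ≈⟨ solve 4 (λ T R R′ E →
        R :- T :* R :+ con ½ :* (T :* (R :* R :+ R :* R′)) := R :- T :* R :+ con ½ :* (T :* R :* (R :+ R′))) refl T R R′ E ⟩
      R - T * R + half * (T * R * (R + R′))          ≈⟨ +-congˡ (*-congˡ (*-congˡ (sym E+E≈R+R′))) ⟩
      R - T * R + half * (T * R * (E + E))           ≈⟨ solve 3 (λ T R E →
        R :- T :* R :+ con ½ :* (T :* R :* (E :+ E)) := R :* ((con 1ℚ :- T) :+ T :* E)) refl T R E ⟩
      R * ((one - T) + T * E)                        ∎

    module WithDerivation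
      (D       : Carrier → Carrier)
      (D-cong  : ∀ {x y} → x ≈ y → D x ≈ D y)
      (D-+     : ∀ x y → D (x + y) ≈ D x + D y)
      (D-neg   : ∀ x → D (- x) ≈ - D x)
      (D-*     : ∀ x y → D (x * y) ≈ D x * y + x * D y)
      (D-const : ∀ q → D ⟦ q ⟧ ≈ ⟦ 0ℚ ⟧)
      where

      D-den : ∀ {ρ e} → D ρ ≈ ⟦ 0ℚ ⟧ → D e ≈ ρ * e → D (den ρ e) ≈ (ρ - one) * (ρ * e)
      D-den {ρ} {e} Dρ≈0 De≈ρe = begin
        D ((one + ρ) + (ρ - one) * e)
          ≈⟨ trans (D-+ _ _) (+-cong (D-+ one ρ) (D-* _ e)) ⟩
        (D one + D ρ) + (D (ρ - one) * e + (ρ - one) * D e)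
          ≈⟨ +-cong (+-cong (D-const 1ℚ) Dρ≈0)
                    (+-cong (*-congʳ (trans (D-+ ρ _) (+-cong Dρ≈0 (trans (D-neg one) (-‿cong (D-const 1ℚ))))))
                            (*-congˡ De≈ρe)) ⟩
        (⟦ 0ℚ ⟧ + ⟦ 0ℚ ⟧) + ((⟦ 0ℚ ⟧ - ⟦ 0ℚ ⟧) * e + (ρ - one) * (ρ * e))
          ≈⟨ solve 2 (λ ρ e → (con 0ℚ :+ con 0ℚ) :+ ((con 0ℚ :- con 0ℚ) :* e :+ (ρ :- con 1ℚ) :* (ρ :* e))
                           := (ρ :- con 1ℚ) :* (ρ :* e)) refl ρ e ⟩
        (ρ - one) * (ρ * e) ∎

      D-num : ∀ {ρ e} → D ρ ≈ ⟦ 0ℚ ⟧ → D e ≈ ρ * e → D (num ρ e) ≈ (ρ + one) * (ρ * e)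
      D-num {ρ} {e} Dρ≈0 De≈ρe = begin
        D ((ρ - one) + (ρ + one) * e)
          ≈⟨ trans (D-+ _ _) (+-cong (D-+ ρ _) (D-* _ e)) ⟩
        (D ρ + D (- one)) + (D (ρ + one) * e + (ρ + one) * D e)
          ≈⟨ +-cong (+-cong Dρ≈0 (trans (D-neg one) (-‿cong (D-const 1ℚ))))
                    (+-cong (*-congʳ (trans (D-+ ρ one) (+-cong Dρ≈0 (D-const 1ℚ)))) (*-congˡ De≈ρe)) ⟩
        (⟦ 0ℚ ⟧ - ⟦ 0ℚ ⟧) + ((⟦ 0ℚ ⟧ + ⟦ 0ℚ ⟧) * e + (ρ + one) * (ρ * e))
          ≈⟨ solve 2 (λ ρ e → (con 0ℚ :- con 0ℚ) :+ ((con 0ℚ :+ con 0ℚ) :* e :+ (ρ :+ con 1ℚ) :* (ρ :* e))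
                           := (ρ :+ con 1ℚ) :* (ρ :* e)) refl ρ e ⟩
        (ρ + one) * (ρ * e) ∎

      quotient-rule : ∀ {R Δ N} → R * Δ ≈ N → D R * Δ * Δ ≈ D N * Δ - N * D Δ
      quotient-rule {R} {Δ} {N} RΔ≈N = begin
        D R * Δ * Δ                            ≈⟨ solve 4 (λ DR R Δ DΔ → DR :* Δ :* Δ := (DR :* Δ :+ R :* DΔ) :* Δ :- (R :* Δ) :* DΔ)
                                                          refl (D R) R Δ (D Δ) ⟩
        (D R * Δ + R * D Δ) * Δ - (R * Δ) * D Δ ≈⟨ +-cong (*-congʳ (trans (sym (D-* R Δ)) (D-cong RΔ≈N)))
                                                          (-‿cong (*-congʳ RΔ≈N)) ⟩
        D N * Δ - N * D Δ                      ∎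

      riccati : ∀ {ρ e d T} → ρ * ρ ≈ one - two * T → D ρ ≈ ⟦ 0ℚ ⟧ → D e ≈ ρ * e → d * den ρ e ≈ one →
                D (closedForm e d) ≈ closedForm e d - T * closedForm e d + half * (T * (closedForm e d * closedForm e d + one))
      riccati {ρ} {e} {d} {T} ρ²≈ Dρ≈0 De≈ρe d*den≈1 = cancel-unit² d*den≈1 (begin
        D R * Δ * Δ
          ≈⟨ quotient-rule RΔ≈N ⟩
        D (num ρ e) * Δ - num ρ e * D Δ
          ≈⟨ +-cong (*-congʳ (D-num Dρ≈0 De≈ρe)) (-‿cong (*-congˡ (D-den Dρ≈0 De≈ρe))) ⟩
        (ρ + one) * (ρ * e) * Δ - num ρ e * ((ρ - one) * (ρ * e))
          ≈⟨ solve 2 (λ ρ e →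
               (ρ :+ con 1ℚ) :* (ρ :* e) :* :den ρ e :- :num ρ e :* ((ρ :- con 1ℚ) :* (ρ :* e))
               := :num ρ e :* :den ρ e :- con ½ :* (con 1ℚ :- ρ :* ρ) :* :num ρ e :* :den ρ e
                  :+ con ½ :* (con ½ :* (con 1ℚ :- ρ :* ρ) :* (:num ρ e :* :num ρ e :+ :den ρ e :* :den ρ e)))
             refl ρ e ⟩
        num ρ e * Δ - half * (one - ρ * ρ) * num ρ e * Δ + half * (half * (one - ρ * ρ) * (num ρ e * num ρ e + Δ * Δ))
          ≈⟨ +-cong (+-congˡ (-‿cong (*-congʳ (*-congʳ T≈)))) (*-congˡ (*-congʳ T≈)) ⟨
        num ρ e * Δ - T * num ρ e * Δ + half * (T * (num ρ e * num ρ e + Δ * Δ))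
          ≈⟨ +-cong (+-cong (*-congʳ (sym RΔ≈N)) (-‿cong (*-congʳ (*-congˡ (sym RΔ≈N)))))
                    (*-congˡ (*-congˡ (+-congʳ (*-cong (sym RΔ≈N) (sym RΔ≈N))))) ⟩
        R * Δ * Δ - T * (R * Δ) * Δ + half * (T * ((R * Δ) * (R * Δ) + Δ * Δ))
          ≈⟨ solve 4 (λ R Δ T h →
               R :* Δ :* Δ :- T :* (R :* Δ) :* Δ :+ con ½ :* (T :* ((R :* Δ) :* (R :* Δ) :+ Δ :* Δ))
               := (R :- T :* R :+ con ½ :* (T :* (R :* R :+ con 1ℚ))) :* Δ :* Δ) refl R Δ T half ⟩
        (R - T * R + half * (T * (R * R + one))) * Δ * Δ ∎)
        where
        R = closedForm e d
        Δ = den ρ e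
        RΔ≈N = closedForm*den≈num d*den≈1
        T≈ : T ≈ half * (one - ρ * ρ)
        T≈ = begin
          T                              ≈⟨ solve 1 (λ T → T := con ½ :* (con 1ℚ :- (con 1ℚ :- con (+ 2 / 1) :* T))) refl T ⟩
          half * (one - (one - two * T)) ≈⟨ *-congˡ (+-congˡ (-‿cong (sym ρ²≈))) ⟩
          half * (one - ρ * ρ)           ∎

      D-*-opposite : ∀ {ρ e f} → D e ≈ ρ * e → D f ≈ - (ρ * f) → D (f * e) ≈ ⟦ 0ℚ ⟧
      D-*-opposite {ρ} {e} {f} De≈ρe Df≈-ρf = begin
        D (f * e)                        ≈⟨ D-* f e ⟩
        D f * e + f * D e                ≈⟨ +-cong (*-congʳ Df≈-ρf) (*-congˡ De≈ρe) ⟩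
        - (ρ * f) * e + f * (ρ * e)      ≈⟨ solve 3 (λ ρ e f → :- (ρ :* f) :* e :+ f :* (ρ :* e) := con 0ℚ) refl ρ e f ⟩
        ⟦ 0ℚ ⟧                           ∎

    module WithReflection
      (σ       : Carrier → Carrier)
      (σ-cong  : ∀ {x y} → x ≈ y → σ x ≈ σ y)
      (σ-+     : ∀ x y → σ (x + y) ≈ σ x + σ y)
      (σ-neg   : ∀ x → σ (- x) ≈ - σ x)
      (σ-*     : ∀ x y → σ (x * y) ≈ σ x * σ y)
      (σ-const : ∀ q → σ ⟦ q ⟧ ≈ ⟦ q ⟧)
      where

      σ-- : ∀ x y → σ (x - y) ≈ σ x - σ y
      σ-- x y = trans (σ-+ x (- y)) (+-congˡ (σ-neg y))

      σ-den : ∀ {ρ e} → σ ρ ≈ ρ → σ (den ρ e) ≈ den ρ (σ e)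
      σ-den {ρ} {e} σρ≈ρ = begin
        σ ((one + ρ) + (ρ - one) * e)              ≈⟨ trans (σ-+ _ _) (+-cong (σ-+ one ρ) (σ-* _ e)) ⟩
        (σ one + σ ρ) + σ (ρ - one) * σ e          ≈⟨ +-cong (+-cong (σ-const 1ℚ) σρ≈ρ)
                                                            (*-congʳ (trans (σ-- ρ one) (+-cong σρ≈ρ (-‿cong (σ-const 1ℚ))))) ⟩
        (one + ρ) + (ρ - one) * σ e                ∎

      σ-inverse : ∀ {ρ e d} → σ ρ ≈ ρ → d * den ρ e ≈ one → σ d * den ρ (σ e) ≈ one
      σ-inverse {ρ} {e} {d} σρ≈ρ d*den≈1 = begin
        σ d * den ρ (σ e)     ≈⟨ *-congˡ (σ-den σρ≈ρ) ⟨
        σ d * σ (den ρ e)     ≈⟨ σ-* d _ ⟨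
        σ (d * den ρ e)       ≈⟨ σ-cong d*den≈1 ⟩
        σ one                 ≈⟨ σ-const 1ℚ ⟩
        one                   ∎

      σ-closedForm : ∀ {e d} → σ (closedForm e d) ≈ closedForm (σ e) (σ d)
      σ-closedForm {e} {d} = begin
        σ (one + (two * (e - one)) * d)              ≈⟨ trans (σ-+ one _) (+-cong (σ-const 1ℚ) (trans (σ-* _ d) (*-congʳ (σ-* two _)))) ⟩
        one + (σ two * σ (e - one)) * σ d            ≈⟨ +-congˡ (*-congʳ (*-cong (σ-const _) (trans (σ-- e one) (+-congˡ (-‿cong (σ-const 1ℚ)))))) ⟩
        one + (two * (σ e - one)) * σ d              ∎

module RationalCasts where

  open import Algebra.Solver.Ring.AlmostCommutativeRing using (fromCommutativeRing)
  open import Data.Integer.Base as ℤ using (ℤ; +_)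
  import Data.Integer.Properties as ℤ
  open import Data.Nat.Base as ℕ using (ℕ; suc; _∸_; _≤_; _!; NonZero)
  import Data.Nat.Properties as ℕ
  open import Data.Nat.Combinatorics using (_C_; nCk≡n!/k![n-k]!; k![n∸k]!∣n!)
  open import Data.Nat.DivMod using (m/n*n≡m)
  open import Data.Rational.Base using (ℚ; 1ℚ; _+_; _*_; _/_; toℚᵘ)
  open import Data.Rational.Properties as ℚ using (toℚᵘ-injective; toℚᵘ-fromℚᵘ; toℚᵘ-homo-+; toℚᵘ-homo-*)
  open import Data.Rational.Unnormalised.Base as ℚᵘ using (mkℚᵘ; *≡*) renaming (_≃_ to _≃ᵘ_)
  import Data.Rational.Unnormalised.Properties as ℚᵘ
  open import Relation.Binary.PropositionalEquality as ≡ using (_≡_; refl; cong; cong₂; module ≡-Reasoning)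

  open import Algebra.Solver.Ring.Simple (fromCommutativeRing ℚ.+-*-commutativeRing) ℚ._≟_
    using (solve; _:=_; _:*_; con)

  fromℕ : ℕ → ℚ
  fromℕ n = + n / 1

  private
    toℚᵘ-/ : ∀ i d .{{_ : NonZero d}} → toℚᵘ (i / d) ≃ᵘ mkℚᵘ i (d ∸ 1)
    toℚᵘ-/ i (suc d) = toℚᵘ-fromℚᵘ (mkℚᵘ i d)

  fromℕ-+ : ∀ m n → fromℕ (m ℕ.+ n) ≡ fromℕ m + fromℕ n
  fromℕ-+ m n = toℚᵘ-injective (ℚᵘ.≃-trans (toℚᵘ-/ (+ (m ℕ.+ n)) 1) (ℚᵘ.≃-trans (*≡* integers)
    (ℚᵘ.≃-sym (ℚᵘ.≃-trans (toℚᵘ-homo-+ (fromℕ m) (fromℕ n)) (ℚᵘ.+-cong (toℚᵘ-/ (+ m) 1) (toℚᵘ-/ (+ n) 1))))))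
    where
    integers : + (m ℕ.+ n) ℤ.* + 1 ≡ (+ m ℤ.* + 1 ℤ.+ + n ℤ.* + 1) ℤ.* + 1
    integers rewrite ℤ.*-identityʳ (+ m) | ℤ.*-identityʳ (+ n) = cong (ℤ._* + 1) (ℤ.pos-+ m n)

  fromℕ-* : ∀ m n → fromℕ (m ℕ.* n) ≡ fromℕ m * fromℕ n
  fromℕ-* m n = toℚᵘ-injective (ℚᵘ.≃-trans (toℚᵘ-/ (+ (m ℕ.* n)) 1) (ℚᵘ.≃-trans (*≡* (cong (ℤ._* + 1) (ℤ.pos-* m n)))
    (ℚᵘ.≃-sym (ℚᵘ.≃-trans (toℚᵘ-homo-* (fromℕ m) (fromℕ n)) (ℚᵘ.*-cong (toℚᵘ-/ (+ m) 1) (toℚᵘ-/ (+ n) 1))))))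

  /-*-fromℕ : ∀ a b .{{_ : NonZero b}} → (+ a / b) * fromℕ b ≡ fromℕ a
  /-*-fromℕ a (suc b) = toℚᵘ-injective (ℚᵘ.≃-trans (toℚᵘ-homo-* (+ a / suc b) (fromℕ (suc b)))
    (ℚᵘ.≃-trans (ℚᵘ.*-cong (toℚᵘ-/ (+ a) (suc b)) (toℚᵘ-/ (+ suc b) 1)) (ℚᵘ.≃-trans (*≡* integers) (ℚᵘ.≃-sym (toℚᵘ-/ (+ a) 1)))))
    where
    integers : (+ a ℤ.* + suc b) ℤ.* + 1 ≡ + a ℤ.* + (suc b ℕ.* 1)
    integers rewrite ℤ.*-identityʳ (+ a ℤ.* + suc b) | ℕ.*-identityʳ b = refl

  *-cancelʳ-fromℕ : ∀ b .{{_ : NonZero b}} {x y : ℚ} → x * fromℕ b ≡ y * fromℕ b → x ≡ y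
  *-cancelʳ-fromℕ b {x} {y} xb≡yb = begin
    x                              ≡⟨ solve 1 (λ x → x := x :* con 1ℚ) refl x ⟩
    x * 1ℚ                         ≡⟨ cong (x *_) (/-*-fromℕ 1 b) ⟨
    x * ((+ 1 / b) * fromℕ b)      ≡⟨ solve 3 (λ x u q → x :* (u :* q) := (x :* q) :* u) refl x (+ 1 / b) (fromℕ b) ⟩
    (x * fromℕ b) * (+ 1 / b)      ≡⟨ cong (_* (+ 1 / b)) xb≡yb ⟩
    (y * fromℕ b) * (+ 1 / b)      ≡⟨ solve 3 (λ y u q → (y :* q) :* u := y :* (u :* q)) refl y (+ 1 / b) (fromℕ b) ⟩
    y * ((+ 1 / b) * fromℕ b)      ≡⟨ cong (y *_) (/-*-fromℕ 1 b) ⟩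
    y * 1ℚ                         ≡⟨ solve 1 (λ y → y :* con 1ℚ := y) refl y ⟩
    y                              ∎
    where open ≡-Reasoning

  /≡fromℕ*inverse : ∀ a b .{{_ : NonZero b}} → + a / b ≡ fromℕ a * (+ 1 / b)
  /≡fromℕ*inverse a b = *-cancelʳ-fromℕ b (begin
    (+ a / b) * fromℕ b               ≡⟨ /-*-fromℕ a b ⟩
    fromℕ a                           ≡⟨ solve 1 (λ a → a := a :* con 1ℚ) refl (fromℕ a) ⟩
    fromℕ a * 1ℚ                      ≡⟨ cong (fromℕ a *_) (/-*-fromℕ 1 b) ⟨
    fromℕ a * ((+ 1 / b) * fromℕ b)   ≡⟨ solve 3 (λ a u q → a :* (u :* q) := (a :* u) :* q) refl (fromℕ a) (+ 1 / b) (fromℕ b) ⟩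
    fromℕ a * (+ 1 / b) * fromℕ b     ∎)
    where open ≡-Reasoning

  invFact : ℕ → ℚ
  invFact n = (+ 1 / n !) {{n ℕ.!≢0}}

  invFact-suc : ∀ n → fromℕ (suc n) * invFact (suc n) ≡ invFact n
  invFact-suc n = *-cancelʳ-fromℕ (n !) {{n ℕ.!≢0}} (begin
    fromℕ (suc n) * invFact (suc n) * fromℕ (n !)     ≡⟨ solve 3 (λ a b c → a :* b :* c := b :* (a :* c)) refl (fromℕ (suc n)) _ (fromℕ (n !)) ⟩
    invFact (suc n) * (fromℕ (suc n) * fromℕ (n !))   ≡⟨ cong (invFact (suc n) *_) (fromℕ-* (suc n) (n !)) ⟨
    invFact (suc n) * fromℕ (suc n !)                 ≡⟨ /-*-fromℕ 1 (suc n !) {{suc n ℕ.!≢0}} ⟩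
    1ℚ                                                ≡⟨ /-*-fromℕ 1 (n !) {{n ℕ.!≢0}} ⟨
    invFact n * fromℕ (n !)                           ∎)
    where open ≡-Reasoning

  invFact-C : ∀ {n i} → i ≤ n → invFact n * fromℕ (n C i) ≡ invFact i * invFact (n ∸ i)
  invFact-C {n} {i} i≤n = *-cancelʳ-fromℕ (n !) {{n ℕ.!≢0}} (begin
    invFact n * fromℕ (n C i) * fromℕ (n !)
      ≡⟨ solve 3 (λ a b c → a :* b :* c := b :* (a :* c)) refl (invFact n) _ (fromℕ (n !)) ⟩
    fromℕ (n C i) * (invFact n * fromℕ (n !))
      ≡⟨ cong (fromℕ (n C i) *_) (/-*-fromℕ 1 (n !) {{n ℕ.!≢0}}) ⟩
    fromℕ (n C i) * 1ℚ
      ≡⟨ cong (fromℕ (n C i) *_) (cong₂ _*_ (/-*-fromℕ 1 (i !) {{i ℕ.!≢0}}) (/-*-fromℕ 1 ((n ∸ i) !) {{(n ∸ i) ℕ.!≢0}})) ⟨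
    fromℕ (n C i) * ((invFact i * fromℕ (i !)) * (invFact (n ∸ i) * fromℕ ((n ∸ i) !)))
      ≡⟨ solve 5 (λ c a x b y → c :* ((x :* a) :* (y :* b)) := (x :* y) :* (c :* (a :* b)))
                 refl (fromℕ (n C i)) (fromℕ (i !)) (invFact i) (fromℕ ((n ∸ i) !)) (invFact (n ∸ i)) ⟩
    invFact i * invFact (n ∸ i) * (fromℕ (n C i) * (fromℕ (i !) * fromℕ ((n ∸ i) !)))
      ≡⟨ cong (invFact i * invFact (n ∸ i) *_) (≡.trans (fromℕ-* (n C i) _) (cong (fromℕ (n C i) *_) (fromℕ-* (i !) _))) ⟨
    invFact i * invFact (n ∸ i) * fromℕ ((n C i) ℕ.* (i ! ℕ.* (n ∸ i) !))
      ≡⟨ cong (λ m → invFact i * invFact (n ∸ i) * fromℕ m) binomial ⟩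
    invFact i * invFact (n ∸ i) * fromℕ (n !) ∎)
    where
    open ≡-Reasoning
    binomial : (n C i) ℕ.* (i ! ℕ.* (n ∸ i) !) ≡ n !
    binomial = ≡.trans (cong (ℕ._* (i ! ℕ.* (n ∸ i) !)) (nCk≡n!/k![n-k]! i≤n))
                       (m/n*n≡m {{i ℕ.!* (n ∸ i) !≢0}} (k![n∸k]!∣n! i≤n))

module JacobiEGF where

  open import Algebra.Bundles using (CommutativeRing)
  open import Algebra.Solver.Ring.AlmostCommutativeRing
    using (_-Raw-AlmostCommutative⟶_; fromCommutativeRing; -raw-almostCommutative⟶)
  open import Data.Bool.Base using (true; false; if_then_else_)
  open import Data.Integer.Base using (+_)
  open import Data.Nat.Base as ℕ using (ℕ; zero; suc; _∸_; _≤_; _!)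
  import Data.Nat.Properties as ℕ
  open import Data.Nat.Combinatorics using (_C_)
  open import Data.Rational.Base as ℚ using (ℚ; 0ℚ; 1ℚ; _/_)
  open import Data.Rational.Properties as ℚ using (+-*-commutativeRing)
  open import Relation.Binary.PropositionalEquality as ≡ using (_≡_; refl; cong; cong₂; module ≡-Reasoning)

  open import Algebra.Properties.CommutativeSemigroup (CommutativeRing.*-commutativeSemigroup +-*-commutativeRing)
    using (interchange; x∙yz≈y∙xz; x∙yz≈zx∙y)

  open Series
  open ClosedForm
  open RationalCasts

  open JacobiPermutations using (jacobiCount-suc; tailCount; splitCount)

  module ℚ[[t]] = PowerSeries +-*-commutativeRing
  module ℚ[[t]][[x]] = PowerSeries ℚ[[t]].seriesRing
  module R₁ = CommutativeRing ℚ[[t]].seriesRing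
  module R₂ = CommutativeRing ℚ[[t]][[x]].seriesRing

  open ℚ[[t]][[x]] using (_≋_; mk≋; _⊕_; ⊝_; _⊛_; const; D; reflect; evenPart)

  embedℚ : ℚ-rawRing -Raw-AlmostCommutative⟶ fromCommutativeRing ℚ[[t]][[x]].seriesRing
  embedℚ = ℚ[[t]][[x]].constantMorphism (ℚ[[t]].constantMorphism (-raw-almostCommutative⟶ _))

  open ℚAlgebra ℚ[[t]][[x]].seriesRing embedℚ using (one; two; den; closedForm; closedForm-reciprocal; riccati⇒ode)

  ≋⇒≈₂ : ∀ {A B} → A ≋ B → A ≈₂ B
  ≋⇒≈₂ A≋B n k = ℚ[[t]].at (ℚ[[t]][[x]].at A≋B n) k

  ≈₂⇒≋ : ∀ {A B} → A ≈₂ B → A ≋ B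
  ≈₂⇒≋ A≈B = mk≋ λ n → ℚ[[t]].mk≋ (A≈B n)

  Σ≤≡∑≤ : ∀ n f → Σ≤ n f ≡ ℚ[[t]].∑≤ n f
  Σ≤≡∑≤ zero    f = refl
  Σ≤≡∑≤ (suc n) f = cong (ℚ._+ f (suc n)) (Σ≤≡∑≤ n f)

  ∑-at : ∀ n F k → ℚ[[t]][[x]].∑≤ n F k ≡ ℚ[[t]].∑≤ n (λ i → F i k)
  ∑-at zero    F k = refl
  ∑-at (suc n) F k = cong (ℚ._+ F (suc n) k) (∑-at n F k)

  ⊛≈₂*₂ : ∀ {A A′ B B′} → A ≈₂ A′ → B ≈₂ B′ → (A ⊛ B) ≈₂ (A′ *₂ B′)
  ⊛≈₂*₂ {A} {A′} {B} {B′} A≈ B≈ n k = begin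
    (A ⊛ B) n k                                                 ≡⟨ ≋⇒≈₂ (ℚ[[t]][[x]].⊛-cong (≈₂⇒≋ A≈) (≈₂⇒≋ B≈)) n k ⟩
    ℚ[[t]][[x]].∑≤ n (λ i → A′ i ℚ[[t]].⊛ B′ (n ∸ i)) k         ≡⟨ ∑-at n _ k ⟩
    ℚ[[t]].∑≤ n (λ i → (A′ i ℚ[[t]].⊛ B′ (n ∸ i)) k)            ≡⟨ ℚ[[t]].∑-congᵉ n (λ i → Σ≤≡∑≤ k _) ⟨
    ℚ[[t]].∑≤ n (λ i → (A′ i *₁ B′ (n ∸ i)) k)                  ≡⟨ Σ≤≡∑≤ n _ ⟨
    (A′ *₂ B′) n k                                              ∎
    where open ≡-Reasoning

  one≈₂ : one ≈₂ one₂
  one≈₂ zero    zero    = refl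
  one≈₂ zero    (suc k) = refl
  one≈₂ (suc n) k       = refl

  two≈₂ : two ≈₂ two₂
  two≈₂ zero    zero    = refl
  two≈₂ zero    (suc k) = refl
  two≈₂ (suc n) k       = refl

  const≈₂ : ∀ r → const r ≈₂ const₂ r
  const≈₂ r zero    k = refl
  const≈₂ r (suc n) k = refl

  module _ (r : Ser₁) (d : Ser₂) where

    den≈₂denom : den (const r) (expX r) ≈₂ denom r
    den≈₂denom n k = cong₂ ℚ._+_ (cong₂ ℚ._+_ (one≈₂ n k) (const≈₂ r n k))
      (⊛≈₂*₂ {A = const r ⊕ ⊝ one} {B = expX r} (λ n k → cong₂ ℚ._+_ (const≈₂ r n k) (cong ℚ.-_ (one≈₂ n k))) (λ _ _ → refl) n k)

    closedForm≈₂ : closedForm (expX r) d ≈₂ (one₂ +₂ ((two₂ *₂ (expX r -₂ one₂)) *₂ d))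
    closedForm≈₂ n k = cong₂ ℚ._+_ (one≈₂ n k)
      (⊛≈₂*₂ {A = two ⊛ (expX r ⊕ ⊝ one)} {B = d}
        (⊛≈₂*₂ {A = two} {B = expX r ⊕ ⊝ one} two≈₂ (λ n k → cong (expX r n k ℚ.+_) (cong ℚ.-_ (one≈₂ n k))))
        (λ _ _ → refl) n k)

  t : Ser₁
  t zero          = 0ℚ
  t (suc zero)    = 1ℚ
  t (suc (suc _)) = 0ℚ

  G : Ser₂ → Ser₂
  G X = (one ⊕ ⊝ const t) ⊕ const t ⊛ evenPart X

  ×-at : ∀ m x k → (m ℚ[[t]][[x]].× x) k ≡ fromℕ m ℚ.* x k
  ×-at zero    x k = ≡.sym (ℚ.*-zeroˡ (x k))
  ×-at (suc m) x k = begin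
    x k ℚ.+ (m ℚ[[t]][[x]].× x) k     ≡⟨ cong (x k ℚ.+_) (×-at m x k) ⟩
    x k ℚ.+ fromℕ m ℚ.* x k           ≡⟨ cong (ℚ._+ fromℕ m ℚ.* x k) (ℚ.*-identityˡ (x k)) ⟨
    1ℚ ℚ.* x k ℚ.+ fromℕ m ℚ.* x k    ≡⟨ ℚ.*-distribʳ-+ (x k) 1ℚ (fromℕ m) ⟨
    (1ℚ ℚ.+ fromℕ m) ℚ.* x k          ≡⟨ cong (ℚ._* x k) (fromℕ-+ 1 m) ⟨
    fromℕ (suc m) ℚ.* x k             ∎
    where open ≡-Reasoning

  ×-cancel : ∀ n {x y} → suc n ℚ[[t]][[x]].× x ℚ[[t]].≋ suc n ℚ[[t]][[x]].× y → x ℚ[[t]].≋ y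
  ×-cancel n {x} {y} nx≋ny = ℚ[[t]].mk≋ λ k → *-cancelʳ-fromℕ (suc n) (begin
    x k ℚ.* fromℕ (suc n)              ≡⟨ ℚ.*-comm (x k) _ ⟩
    fromℕ (suc n) ℚ.* x k              ≡⟨ ×-at (suc n) x k ⟨
    (suc n ℚ[[t]][[x]].× x) k           ≡⟨ ℚ[[t]].at nx≋ny k ⟩
    (suc n ℚ[[t]][[x]].× y) k           ≡⟨ ×-at (suc n) y k ⟩
    fromℕ (suc n) ℚ.* y k              ≡⟨ ℚ.*-comm _ (y k) ⟩
    y k ℚ.* fromℕ (suc n)              ∎)
    where open ≡-Reasoning

  D-expX : ∀ r → D (expX r) ≋ const r ⊛ expX r
  D-expX r = ≈₂⇒≋ λ n k → begin
    (suc n ℚ[[t]][[x]].× expX r (suc n)) k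
      ≡⟨ ×-at (suc n) (expX r (suc n)) k ⟩
    fromℕ (suc n) ℚ.* ((r ^₁ suc n) k ℚ.* invFact (suc n))
      ≡⟨ ℚ.*-comm (fromℕ (suc n)) _ ⟩
    ((r ^₁ suc n) k ℚ.* invFact (suc n)) ℚ.* fromℕ (suc n)
      ≡⟨ ℚ.*-assoc ((r ^₁ suc n) k) _ _ ⟩
    (r ^₁ suc n) k ℚ.* (invFact (suc n) ℚ.* fromℕ (suc n))
      ≡⟨ cong ((r ^₁ suc n) k ℚ.*_) (≡.trans (ℚ.*-comm (invFact (suc n)) _) (invFact-suc n)) ⟩
    Σ≤ k (λ i → r i ℚ.* (r ^₁ n) (k ∸ i)) ℚ.* invFact n
      ≡⟨ cong (ℚ._* invFact n) (Σ≤≡∑≤ k _) ⟩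
    ℚ[[t]].∑≤ k (λ i → r i ℚ.* (r ^₁ n) (k ∸ i)) ℚ.* invFact n
      ≡⟨ ℚ[[t]].∑-distribʳ k (invFact n) _ ⟩
    ℚ[[t]].∑≤ k (λ i → r i ℚ.* (r ^₁ n) (k ∸ i) ℚ.* invFact n)
      ≡⟨ ℚ[[t]].∑-congᵉ k (λ i → ℚ.*-assoc (r i) _ _) ⟩
    (r ℚ[[t]].⊛ expX r n) k
      ≡⟨ ≋⇒≈₂ (ℚ[[t]][[x]].const-⊛ r (expX r)) n k ⟨
    (const r ⊛ expX r) n k ∎
    where open ≡-Reasoning

  ⟦0⟧≋𝟘 : const (ℚ[[t]].const 0ℚ) ≋ ℚ[[t]][[x]].𝟘
  ⟦0⟧≋𝟘 = ≈₂⇒≋ λ where zero zero → refl ; zero (suc k) → refl ; (suc n) k → refl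

  module Derivation = ℚAlgebra.WithDerivation ℚ[[t]][[x]].seriesRing embedℚ
    D ℚ[[t]][[x]].D-cong ℚ[[t]][[x]].D-⊕ ℚ[[t]][[x]].D-⊝ ℚ[[t]][[x]].D-⊛
    (λ q → R₂.trans (ℚ[[t]][[x]].D-const (ℚ[[t]].const q)) (R₂.sym ⟦0⟧≋𝟘))

  module Reflection = ℚAlgebra.WithReflection ℚ[[t]][[x]].seriesRing embedℚ
    reflect ℚ[[t]][[x]].reflect-cong ℚ[[t]][[x]].reflect-⊕ ℚ[[t]][[x]].reflect-⊝ ℚ[[t]][[x]].reflect-⊛
    (λ _ → ℚ[[t]][[x]].reflect-const _)

  r²≋ : ∀ r → (∀ k → (r *₁ r) k ≡ oneMinus2t k) → const r ⊛ const r R₂.≈ one R₂.- two ⊛ const t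
  r²≋ r rr = begin
    const r ⊛ const r                                   ≈⟨ ℚ[[t]][[x]].const-⊛-const r r ⟩
    const (r ℚ[[t]].⊛ r)                                ≈⟨ ℚ[[t]][[x]].const-cong (ℚ[[t]].mk≋ coefficients) ⟩
    const (ℚ[[t]].𝟙 ℚ[[t]].⊕ ℚ[[t]].⊝ (ℚ[[t]].const (+ 2 / 1) ℚ[[t]].⊛ t))
      ≈⟨ ℚ[[t]][[x]].const-⊕ _ _ ⟨
    one ⊕ const (ℚ[[t]].⊝ (ℚ[[t]].const (+ 2 / 1) ℚ[[t]].⊛ t))
      ≈⟨ R₂.+-congˡ {one} (R₂.trans (R₂.-‿cong (ℚ[[t]][[x]].const-⊛-const _ t)) (ℚ[[t]][[x]].const-⊝ _)) ⟨
    one R₂.- two ⊛ const t                              ∎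
    where
    open import Relation.Binary.Reasoning.Setoid R₂.setoid
    coefficients : ∀ k → (r ℚ[[t]].⊛ r) k ≡ (ℚ[[t]].𝟙 ℚ[[t]].⊕ ℚ[[t]].⊝ (ℚ[[t]].const (+ 2 / 1) ℚ[[t]].⊛ t)) k
    coefficients k = ≡.trans (≡.sym (Σ≤≡∑≤ k _)) (≡.trans (rr k) (≡.trans (1-2t k)
      (cong (λ c → ℚ[[t]].𝟙 k ℚ.+ ℚ.- c) (≡.sym (ℚ[[t]].at (ℚ[[t]].const-⊛ (+ 2 / 1) t) k)))))
      where
      1-2t : ∀ k → oneMinus2t k ≡ ℚ[[t]].𝟙 k ℚ.+ ℚ.- ((+ 2 / 1) ℚ.* t k)
      1-2t zero          = refl
      1-2t (suc zero)    = refl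
      1-2t (suc (suc k)) = refl

  expX-0 : ∀ r → expX r 0 ℚ[[t]].≋ ℚ[[t]].𝟙
  expX-0 r = ℚ[[t]].mk≋ λ where zero → refl ; (suc k) → refl

  module ClosedFormSolution (r : Ser₁) (rr : ∀ k → (r *₁ r) k ≡ oneMinus2t k)
                            (d : Ser₂) (dD : (d *₂ denom r) ≈₂ one₂) where

    open import Relation.Binary.Reasoning.Setoid R₂.setoid

    ρ e R : Ser₂
    ρ = const r
    e = expX r
    R = closedForm e d

    d*den≈1 : d ⊛ den ρ e R₂.≈ one
    d*den≈1 = ≈₂⇒≋ λ n k → ≡.trans (⊛≈₂*₂ {A = d} {B = den ρ e} (λ _ _ → refl) (den≈₂denom r d) n k)
                                   (≡.trans (dD n k) (≡.sym (one≈₂ n k)))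

    reflect-e*e≈1 : reflect e ⊛ e R₂.≈ one
    reflect-e*e≈1 = begin
      reflect e ⊛ e                  ≈⟨ ℚ[[t]][[x]].D≋𝟘⇒≋const ×-cancel (R₂.trans (Derivation.D-*-opposite {ρ} {e} {reflect e} (D-expX r) D-reflect-e) ⟦0⟧≋𝟘) ⟩
      const ((reflect e ⊛ e) 0)      ≈⟨ ℚ[[t]][[x]].const-cong (R₁.trans (ℚ[[t]].⊛-cong (expX-0 r) (expX-0 r)) (ℚ[[t]].⊛-identityˡ ℚ[[t]].𝟙)) ⟩
      one                            ∎
      where
      D-reflect-e : D (reflect e) R₂.≈ ⊝ (ρ ⊛ reflect e)
      D-reflect-e = begin
        D (reflect e)             ≈⟨ ℚ[[t]][[x]].D-reflect e ⟩
        ⊝ reflect (D e)           ≈⟨ R₂.-‿cong (ℚ[[t]][[x]].reflect-cong (D-expX r)) ⟩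
        ⊝ reflect (ρ ⊛ e)         ≈⟨ R₂.-‿cong (R₂.trans (ℚ[[t]][[x]].reflect-⊛ ρ e) (R₂.*-congʳ {reflect e} (ℚ[[t]][[x]].reflect-const r))) ⟩
        ⊝ (ρ ⊛ reflect e)         ∎

    R*reflect-R≈1 : R ⊛ reflect R R₂.≈ one
    R*reflect-R≈1 = R₂.trans (R₂.*-congˡ {R} (Reflection.σ-closedForm {e} {d}))
      (closedForm-reciprocal {ρ} {e} {reflect e} {d} {reflect d} reflect-e*e≈1 d*den≈1
        (Reflection.σ-inverse {ρ} {e} {d} (ℚ[[t]][[x]].reflect-const r) d*den≈1))

    closedForm-ode : D R R₂.≈ R ⊛ G R
    closedForm-ode = riccati⇒ode {const t} {R} {reflect R} {evenPart R} {D R} R*reflect-R≈1 (ℚ[[t]][[x]].evenPart-⊕ R)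
      (Derivation.riccati {ρ} {e} {d} {const t} (r²≋ r rr) (R₂.trans (ℚ[[t]][[x]].D-const r) (R₂.sym ⟦0⟧≋𝟘)) (D-expX r) d*den≈1)

  fromℕ-∑ : ∀ n f → fromℕ (Counting.∑≤ n f) ≡ ℚ[[t]].∑≤ n (λ i → fromℕ (f i))
  fromℕ-∑ zero    f = refl
  fromℕ-∑ (suc n) f = ≡.trans (fromℕ-+ (Counting.∑≤ n f) (f (suc n))) (cong (ℚ._+ fromℕ (f (suc n))) (fromℕ-∑ n f))

  jacobiEGF-at : ∀ n k → jacobiEGF n k ≡ fromℕ (jacobiCount n k) ℚ.* invFact n
  jacobiEGF-at n k = /≡fromℕ*inverse (jacobiCount n k) (n !) {{n ℕ.!≢0}}

  t⊛-at : ∀ y l → (t ℚ[[t]].⊛ y) (suc l) ≡ y l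
  t⊛-at y l = ≡.trans (ℚ[[t]].∑-suc l _)
    (≡.trans (cong (ℚ._+ ℚ[[t]].∑≤ l (λ i → t (suc i) ℚ.* y (l ∸ i))) (ℚ.*-zeroˡ (y (suc l))))
             (≡.trans (ℚ.+-identityˡ _) (shifted l)))
    where
    shifted : ∀ l → ℚ[[t]].∑≤ l (λ i → t (suc i) ℚ.* y (l ∸ i)) ≡ y l
    shifted zero    = ℚ.*-identityˡ (y 0)
    shifted (suc l) = ≡.trans (ℚ[[t]].∑-suc l _)
      (≡.trans (cong₂ ℚ._+_ (ℚ.*-identityˡ (y (suc l))) (ℚ[[t]].∑-zero l λ i _ → ℚ.*-zeroˡ (y (l ∸ i))))
               (ℚ.+-identityʳ _))

  G-jacobiEGF-at : ∀ m l → G jacobiEGF m l ≡ fromℕ (tailCount m l) ℚ.* invFact m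
  G-jacobiEGF-at zero    zero          = refl
  G-jacobiEGF-at zero    (suc zero)    = cong (λ c → (0ℚ ℚ.+ ℚ.- 1ℚ) ℚ.+ c) (t⊛-at (evenPart jacobiEGF 0) 0)
  G-jacobiEGF-at zero    (suc (suc l)) = cong (λ c → (0ℚ ℚ.+ ℚ.- 0ℚ) ℚ.+ c) (t⊛-at (evenPart jacobiEGF 0) (suc l))
  G-jacobiEGF-at (suc m) zero          = ≡.trans
    (cong (λ c → (0ℚ ℚ.+ ℚ.- 0ℚ) ℚ.+ c)
          (≡.trans (≋⇒≈₂ (ℚ[[t]][[x]].const-⊛ t (evenPart jacobiEGF)) (suc m) 0) (ℚ.*-zeroˡ (evenPart jacobiEGF (suc m) 0))))
    (≡.sym (ℚ.*-zeroˡ (invFact (suc m))))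
  G-jacobiEGF-at (suc m) (suc l) = ≡.trans
    (cong (λ c → (0ℚ ℚ.+ ℚ.- 0ℚ) ℚ.+ c)
          (≡.trans (≋⇒≈₂ (ℚ[[t]][[x]].const-⊛ t (evenPart jacobiEGF)) (suc m) (suc l)) (t⊛-at (evenPart jacobiEGF (suc m)) l)))
    (≡.trans (ℚ.+-identityˡ _) (by-parity (evenᵇ (suc m))))
    where
    by-parity : ∀ b → (if b then jacobiEGF (suc m) else R₁.0#) l ≡ fromℕ (if b then jacobiCount (suc m) l else 0) ℚ.* invFact (suc m)
    by-parity true  = jacobiEGF-at (suc m) l
    by-parity false = ≡.sym (ℚ.*-zeroˡ (invFact (suc m)))

  D-jacobiEGF-at : ∀ n k → D jacobiEGF n k ≡ fromℕ (jacobiCount (suc n) k) ℚ.* invFact n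
  D-jacobiEGF-at n k = begin
    (suc n ℚ[[t]][[x]].× jacobiEGF (suc n)) k                    ≡⟨ ×-at (suc n) (jacobiEGF (suc n)) k ⟩
    fromℕ (suc n) ℚ.* jacobiEGF (suc n) k                        ≡⟨ cong (fromℕ (suc n) ℚ.*_) (jacobiEGF-at (suc n) k) ⟩
    fromℕ (suc n) ℚ.* (fromℕ J ℚ.* invFact (suc n))              ≡⟨ x∙yz≈y∙xz (fromℕ (suc n)) (fromℕ J) _ ⟩
    fromℕ J ℚ.* (fromℕ (suc n) ℚ.* invFact (suc n))              ≡⟨ cong (fromℕ J ℚ.*_) (invFact-suc n) ⟩
    fromℕ J ℚ.* invFact n                                        ∎
    where
    open ≡-Reasoning
    J = jacobiCount (suc n) k

  jacobiEGF-⊛-at : ∀ n k → (jacobiEGF ⊛ G jacobiEGF) n k ≡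
                   fromℕ (Counting.∑≤ n (λ i → (n C i) ℕ.* splitCount k i (n ∸ i))) ℚ.* invFact n
  jacobiEGF-⊛-at n k = begin
    (jacobiEGF ⊛ G jacobiEGF) n k
      ≡⟨ ∑-at n _ k ⟩
    ℚ[[t]].∑≤ n (λ i → (jacobiEGF i ℚ[[t]].⊛ G jacobiEGF (n ∸ i)) k)
      ≡⟨ ℚ[[t]].∑-cong n (λ i i≤n → ≡.trans (inner i (n ∸ i)) (outer i i≤n)) ⟩
    ℚ[[t]].∑≤ n (λ i → fromℕ ((n C i) ℕ.* splitCount k i (n ∸ i)) ℚ.* invFact n)
      ≡⟨ ℚ[[t]].∑-distribʳ n (invFact n) _ ⟨
    ℚ[[t]].∑≤ n (λ i → fromℕ ((n C i) ℕ.* splitCount k i (n ∸ i))) ℚ.* invFact n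
      ≡⟨ cong (ℚ._* invFact n) (fromℕ-∑ n _) ⟨
    fromℕ (Counting.∑≤ n (λ i → (n C i) ℕ.* splitCount k i (n ∸ i))) ℚ.* invFact n ∎
    where
    open ≡-Reasoning
    inner : ∀ i m → (jacobiEGF i ℚ[[t]].⊛ G jacobiEGF m) k ≡ fromℕ (splitCount k i m) ℚ.* (invFact i ℚ.* invFact m)
    inner i m = begin
      ℚ[[t]].∑≤ k (λ j → jacobiEGF i j ℚ.* G jacobiEGF m (k ∸ j))
        ≡⟨ ℚ[[t]].∑-congᵉ k (λ j → ≡.trans (cong₂ ℚ._*_ (jacobiEGF-at i j) (G-jacobiEGF-at m (k ∸ j)))
                                            (≡.trans (interchange (fromℕ (jacobiCount i j)) (invFact i) (fromℕ (tailCount m (k ∸ j))) (invFact m))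
                                                     (cong (ℚ._* _) (≡.sym (fromℕ-* (jacobiCount i j) (tailCount m (k ∸ j))))))) ⟩
      ℚ[[t]].∑≤ k (λ j → fromℕ (jacobiCount i j ℕ.* tailCount m (k ∸ j)) ℚ.* (invFact i ℚ.* invFact m))
        ≡⟨ ℚ[[t]].∑-distribʳ k _ _ ⟨
      ℚ[[t]].∑≤ k (λ j → fromℕ (jacobiCount i j ℕ.* tailCount m (k ∸ j))) ℚ.* (invFact i ℚ.* invFact m)
        ≡⟨ cong (ℚ._* _) (fromℕ-∑ k _) ⟨
      fromℕ (splitCount k i m) ℚ.* (invFact i ℚ.* invFact m) ∎
    outer : ∀ i → i ≤ n → fromℕ (splitCount k i (n ∸ i)) ℚ.* (invFact i ℚ.* invFact (n ∸ i)) ≡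
                          fromℕ ((n C i) ℕ.* splitCount k i (n ∸ i)) ℚ.* invFact n
    outer i i≤n = begin
      fromℕ s ℚ.* (invFact i ℚ.* invFact (n ∸ i))   ≡⟨ cong (fromℕ s ℚ.*_) (invFact-C i≤n) ⟨
      fromℕ s ℚ.* (invFact n ℚ.* fromℕ (n C i))     ≡⟨ x∙yz≈zx∙y (fromℕ s) (invFact n) (fromℕ (n C i)) ⟩
      fromℕ (n C i) ℚ.* fromℕ s ℚ.* invFact n       ≡⟨ cong (ℚ._* invFact n) (fromℕ-* (n C i) s) ⟨
      fromℕ ((n C i) ℕ.* s) ℚ.* invFact n           ∎
      where s = splitCount k i (n ∸ i)

  jacobiEGF-ode : D jacobiEGF ≋ jacobiEGF ⊛ G jacobiEGF
  jacobiEGF-ode = ≈₂⇒≋ λ n k → begin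
    D jacobiEGF n k                                   ≡⟨ D-jacobiEGF-at n k ⟩
    fromℕ (jacobiCount (suc n) k) ℚ.* invFact n       ≡⟨ cong (λ c → fromℕ c ℚ.* invFact n) (jacobiCount-suc n k) ⟩
    fromℕ (Counting.∑≤ n (λ i → (n C i) ℕ.* splitCount k i (n ∸ i))) ℚ.* invFact n ≡⟨ jacobiEGF-⊛-at n k ⟨
    (jacobiEGF ⊛ G jacobiEGF) n k                     ∎
    where open ≡-Reasoning

  G-causal : ℚ[[t]][[x]].Causal G
  G-causal {X} {Y} m X≈Y = R₁.+-congˡ {(one ⊕ ⊝ const t) m}
    (ℚ[[t]][[x]].∑-cong m λ i _ → R₁.*-congˡ {const t i} (evenPart≈ (m ∸ i) (ℕ.m∸n≤m m i)))
    where
    evenPart≈ : ∀ j → j ≤ m → evenPart X j R₁.≈ evenPart Y j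
    evenPart≈ j j≤m with evenᵇ j
    ... | true  = X≈Y j j≤m
    ... | false = R₁.refl

  jacobiEGF-0 : jacobiEGF 0 R₁.≈ ℚ[[t]].𝟙
  jacobiEGF-0 = ℚ[[t]].mk≋ λ where zero → refl ; (suc k) → refl

  closedForm-0 : ∀ r d → closedForm (expX r) d 0 R₁.≈ ℚ[[t]].𝟙
  closedForm-0 r d = begin
    ℚ[[t]].𝟙 R₁.+ (two 0 R₁.* (expX r 0 R₁.- ℚ[[t]].𝟙)) R₁.* d 0
      ≈⟨ R₁.+-congˡ {ℚ[[t]].𝟙} (R₁.*-congʳ {d 0} (R₁.*-congˡ {two 0}
           (R₁.trans (R₁.+-congʳ {R₁.- ℚ[[t]].𝟙} (expX-0 r)) (R₁.-‿inverseʳ ℚ[[t]].𝟙)))) ⟩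
    ℚ[[t]].𝟙 R₁.+ (two 0 R₁.* R₁.0#) R₁.* d 0
      ≈⟨ R₁.+-congˡ {ℚ[[t]].𝟙} (R₁.trans (R₁.*-congʳ {d 0} (R₁.zeroʳ (two 0))) (R₁.zeroˡ (d 0))) ⟩
    ℚ[[t]].𝟙 R₁.+ R₁.0#
      ≈⟨ R₁.+-identityʳ ℚ[[t]].𝟙 ⟩
    ℚ[[t]].𝟙 ∎
    where open import Relation.Binary.Reasoning.Setoid R₁.setoid

  jacobiEGF≋closedForm : ∀ r → (∀ k → (r *₁ r) k ≡ oneMinus2t k) → ∀ d → (d *₂ denom r) ≈₂ one₂ →
                         jacobiEGF ≋ closedForm (expX r) d
  jacobiEGF≋closedForm r rr d dD = ℚ[[t]][[x]].D≋⊛-unique ×-cancel G G-causal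
    (R₁.trans jacobiEGF-0 (R₁.sym (closedForm-0 r d)))
    jacobiEGF-ode (ClosedFormSolution.closedForm-ode r rr d dD)

open import Relation.Binary.PropositionalEquality using (trans)
open JacobiEGF using (jacobiEGF≋closedForm; closedForm≈₂; ≋⇒≈₂)

theorem2p4 : (r : Ser₁) → r 0 ≡ 1ℚ → (∀ k → (r *₁ r) k ≡ oneMinus2t k) →
    (d : Ser₂) → (d *₂ denom r) ≈₂ one₂ →
    jacobiEGF ≈₂ (one₂ +₂ ((two₂ *₂ (expX r -₂ one₂)) *₂ d))
theorem2p4 r _ rr d dD n k = trans (≋⇒≈₂ (jacobiEGF≋closedForm r rr d dD) n k) (closedForm≈₂ r d n k)
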